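{- For $r\geq 2$ and odd $s\geq 3$, $\operatorname{zir}(H(r,s))=2$, $\operatorname{Z}(H(r,s))=r$, and $\operatorname{ZIR}(H(r,s))=r+\frac{s-1}{2}$. For $r\geq 2$ and odd $s\geq 5$, $\overline{\operatorname{Z}}(H(r,s))=r+1$. For $r\geq 2$, $\overline{\operatorname{Z}}(H(r,3))=r$.
   Context: For $r\ge 2$ and odd $s\ge 3$, $H(r,s)$ is the graph on $r+s+1$ vertices obtained as follows: take the complete bipartite graph $K_{2,r}$ with smaller part $\{u,u'\}$ and larger part $\{w_1,\dots,w_r\}$, and the path $P_s$ with vertices $y_1,\dots,y_s$ in path order, and identify $u'$ with $y_s$. Zero forcing: from a set $B$ of blue vertices, a blue vertex $u$ may turn a white vertex $w$ blue if $w$ is the only white neighbor of $u$; $B$ is a zero forcing set if eventually all vertices are blue. $\operatorname{Z}(G)$ is the minimum size of a zero forcing set; $\overline{\operatorname{Z}}(G)$ is the maximum size of an inclusion-minimal zero forcing set. A fort is a nonempty $F\subseteq V(G)$ such that every $v\notin F$ has $|F\cap N(v)|\neq 1$. For $S\subseteq V(G)$, $x\in S$, a private fort of $x$ relative to $S$ is a fort $F$ with $S\cap F=\{x\}$; $S$ is a ZIr-set if every element has a private fort. $\operatorname{zir}(G)$ and $\operatorname{ZIR}(G)$ are the minimum and maximum cardinality of an inclusion-maximal ZIr-set of $G$. -}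

module Defs where

open import Data.Bool.Base using (Bool; true; false; _∧_; _∨_)
open import Data.Nat.Base using (ℕ; zero; suc; _+_; _≤_; _≤ᵇ_; _≡ᵇ_)
open import Data.Fin.Base using (Fin; toℕ)
open import Data.Fin.Subset using (Subset; _∈_; _∉_; _⊂_; _∩_; _∪_; ⁅_⁆; ∣_∣; Nonempty)
open import Data.Vec.Base using (tabulate)
open import Data.Product using (Σ; _×_; ∃)
open import Relation.Binary.PropositionalEquality using (_≡_; _≢_)

Graph : ℕ → Set
Graph n = Fin n → Fin n → Bool

module _ {n : ℕ} (G : Graph n) where

  N : Fin n → Subset n
  N v = tabulate (G v)

  data ZFReaches : Subset n → Set where
    done  : ∀ {B} → (∀ v → v ∈ B) → ZFReaches B
    force : ∀ {B} (u w : Fin n) → u ∈ B → w ∉ B → G u w ≡ true →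
            (∀ v → G u v ≡ true → v ≢ w → v ∈ B) →
            ZFReaches (⁅ w ⁆ ∪ B) → ZFReaches B

  IsZFS : Subset n → Set
  IsZFS B = ZFReaches B

  IsMinimalZFS : Subset n → Set
  IsMinimalZFS B = IsZFS B × (∀ S → S ⊂ B → ¬ IsZFS S)
    where open import Relation.Nullary using (¬_)

  IsFort : Subset n → Set
  IsFort F = Nonempty F × (∀ v → v ∉ F → ∣ F ∩ N v ∣ ≢ 1)

  IsZIr : Subset n → Set
  IsZIr S = ∀ x → x ∈ S → ∃ λ F → IsFort F × (S ∩ F ≡ ⁅ x ⁆)

  IsMaximalZIr : Subset n → Set
  IsMaximalZIr S = IsZIr S × (∀ T → S ⊂ T → ¬ IsZIr T)
    where open import Relation.Nullary using (¬_)

IsMinCard : ∀ {n} → (Subset n → Set) → ℕ → Set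
IsMinCard P k = (∃ λ S → P S × ∣ S ∣ ≡ k) × (∀ S → P S → k ≤ ∣ S ∣)

IsMaxCard : ∀ {n} → (Subset n → Set) → ℕ → Set
IsMaxCard P k = (∃ λ S → P S × ∣ S ∣ ≡ k) × (∀ S → P S → ∣ S ∣ ≤ k)

-- Graph parameters: "Z G k" means Z(G) = k, etc.
ZeroForcingNumber : ∀ {n} → Graph n → ℕ → Set
ZeroForcingNumber G = IsMinCard (IsZFS G)

UpperZeroForcingNumber : ∀ {n} → Graph n → ℕ → Set
UpperZeroForcingNumber G = IsMaxCard (IsMinimalZFS G)

zirNumber : ∀ {n} → Graph n → ℕ → Set
zirNumber G = IsMinCard (IsMaximalZIr G)

ZIRNumber : ∀ {n} → Graph n → ℕ → Set
ZIRNumber G = IsMaxCard (IsMaximalZIr G)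

-- H(r,s) on r+s+1 vertices, numbered:
--   0 = u ;  i = w_i (1 ≤ i ≤ r) ;  r + j = y_j (1 ≤ j ≤ s), with y_s = u'.
-- Edges: u ~ w_i, w_i ~ y_s, y_j ~ y_{j+1}.
Hedge : ℕ → ℕ → ℕ → ℕ → Bool
Hedge r s a b =
     ((a ≡ᵇ 0) ∧ (1 ≤ᵇ b) ∧ (b ≤ᵇ r))
  ∨ ((1 ≤ᵇ a) ∧ (a ≤ᵇ r) ∧ (b ≡ᵇ r + s))
  ∨ ((suc r ≤ᵇ a) ∧ (b ≡ᵇ suc a) ∧ (b ≤ᵇ r + s))

H : (r s : ℕ) → Graph (r + s + 1)
H r s i j = Hedge r s (toℕ i) (toℕ j) ∨ Hedge r s (toℕ j) (toℕ i)

{-# OPTIONS --safe #-}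
-- Everything is read off the forts of H(r,s). A zero forcing set meets every fort, and H(r,s) has the forts
-- {wᵢ, wⱼ}, {u} ∪ W, W ∪ P and {u} ∪ C ∪ (P ∖ X), for C ⊆ W and X an independent set of inner path vertices.
-- On the other hand every fort F is rigid along the path: if y₁ ∉ F then F misses the path, otherwise no two
-- consecutive path vertices lie outside F; and if F misses some wᵢ, then u ∈ F iff yₛ ∈ F.
-- So a zero forcing set contains W up to one vertex wᵢ, and then also u, y₁, yₛ or two adjacent path vertices;
-- these few sets force everything, which gives Z = r and bounds minimal zero forcing sets by r + 1 (by r if s = 3).
-- In a ZIr-set the private forts of path vertices contain y₁, so apart from one vertex its path part avoids y₁ and
-- has no two adjacent vertices: at most (s − 1)/2 of them, and a case analysis on u and W yields ZIR = r + (s − 1)/2,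
-- attained by W ∪ {y₂, y₄, …, yₛ₋₁}. Finally {u, y₁} is a maximal ZIr-set, and every ZIr-set of size ≤ 1 extends.
module Submission where

open import Defs
open import Data.Bool.Base using (Bool; true; false; _∧_; _∨_; not; T; if_then_else_)
open import Data.Bool.Properties using (¬-not; not-¬; ∧-identityʳ; ∧-zeroʳ; not-involutive)
open import Data.Empty using (⊥-elim) renaming (⊥ to Empty)
open import Data.Fin.Base using (Fin; toℕ; fromℕ<) renaming (zero to fzero; suc to fsuc)
open import Data.Fin.Properties using (toℕ-injective; toℕ<n; toℕ-fromℕ<; any?) renaming (_≟_ to _≟ᶠ_)
open import Data.Fin.Subset
  using (Subset; _∈_; _∉_; _⊆_; _⊂_; _∩_; _∪_; ⁅_⁆; ∣_∣; Nonempty)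
  renaming (⊥ to ∅)
open import Data.Fin.Subset.Properties
  using (_∈?_; x∈⁅x⁆; x∈⁅y⁆⇒x≡y; x∈p∪q⁺; x∈p∪q⁻; x∈p∩q⁺; x∈p∩q⁻; ∣⁅x⁆∣≡1; ⊆-antisym;
         Empty-unique; ∣⊥∣≡0; p⊆q⇒∣p∣≤∣q∣)
open import Data.Nat.Base
open import Data.Nat.DivMod using (m≡m%n+[m/n]*n; m*n/n≡m)
open import Data.Nat.Properties
open import Data.Nat.Solver using (module +-*-Solver)
open import Algebra.Properties.CommutativeSemigroup +-commutativeSemigroup using (x∙yz≈y∙xz)
open import Data.Product using (∃; ∃₂; _×_; _,_; proj₁; proj₂; map₂)
open import Data.Sum.Base using (_⊎_; inj₁; inj₂; [_,_]′) renaming (map to map-⊎)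
open import Data.Vec.Base using ([]; _∷_; tabulate; here; there)
open import Data.Vec.Properties using (lookup∘tabulate; []=⇒lookup; lookup⇒[]=)
open import Function using (case_of_; _∘_; id)
open import Relation.Binary.PropositionalEquality
open import Relation.Nullary using (¬_; Dec; yes; no)
open import Relation.Nullary.Decidable using (_×-dec_)

∨-true⁻ : ∀ x {y} → (x ∨ y) ≡ true → x ≡ true ⊎ y ≡ true
∨-true⁻ true  _ = inj₁ refl
∨-true⁻ false e = inj₂ e

∨-trueˡ : ∀ {x} y → x ≡ true → (x ∨ y) ≡ true
∨-trueˡ _ refl = refl

∨-trueʳ : ∀ x {y} → y ≡ true → (x ∨ y) ≡ true
∨-trueʳ true  _    = refl
∨-trueʳ false refl = refl

∧-true⁻ : ∀ x {y} → (x ∧ y) ≡ true → x ≡ true × y ≡ true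
∧-true⁻ true refl = refl , refl

∧-true⁺ : ∀ {x y} → x ≡ true → y ≡ true → (x ∧ y) ≡ true
∧-true⁺ refl refl = refl

not≡false⇒≡true : ∀ {b} → not b ≡ false → b ≡ true
not≡false⇒≡true {true} _ = refl

not≡true⇒≡false : ∀ {b} → not b ≡ true → b ≡ false
not≡true⇒≡false {false} _ = refl

≡ᵇ≡true⇒≡ : ∀ a b → (a ≡ᵇ b) ≡ true → a ≡ b
≡ᵇ≡true⇒≡ a b e = ≡ᵇ⇒≡ a b (subst T (sym e) _)

≡⇒≡ᵇ≡true : ∀ a b → a ≡ b → (a ≡ᵇ b) ≡ true
≡⇒≡ᵇ≡true a b e with a ≡ᵇ b | ≡⇒≡ᵇ a b e
... | true | _ = refl

≢⇒≡ᵇ≡false : ∀ a b → a ≢ b → (a ≡ᵇ b) ≡ false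
≢⇒≡ᵇ≡false a b a≢b = ¬-not (a≢b ∘ ≡ᵇ≡true⇒≡ a b)

≡ᵇ-refl : ∀ a → (a ≡ᵇ a) ≡ true
≡ᵇ-refl a = ≡⇒≡ᵇ≡true a a refl

≤ᵇ≡true⇒≤ : ∀ a b → (a ≤ᵇ b) ≡ true → a ≤ b
≤ᵇ≡true⇒≤ a b e = ≤ᵇ⇒≤ a b (subst T (sym e) _)

≤⇒≤ᵇ≡true : ∀ {a b} → a ≤ b → (a ≤ᵇ b) ≡ true
≤⇒≤ᵇ≡true {a} {b} a≤b with a ≤ᵇ b | ≤⇒≤ᵇ a≤b
... | true | _ = refl

≰⇒≤ᵇ≡false : ∀ a b → a ≰ b → (a ≤ᵇ b) ≡ false
≰⇒≤ᵇ≡false a b a≰b = ¬-not (a≰b ∘ ≤ᵇ≡true⇒≤ a b)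

pair : ℕ → ℕ → ℕ → Bool
pair x y z = (z ≡ᵇ x) ∨ (z ≡ᵇ y)

pair-≢ : ∀ x y z → z ≢ x → z ≢ y → pair x y z ≡ false
pair-≢ x y z z≢x z≢y = cong₂ _∨_ (≢⇒≡ᵇ≡false z x z≢x) (≢⇒≡ᵇ≡false z y z≢y)

pair⁻ : ∀ x y z → pair x y z ≡ true → z ≡ x ⊎ z ≡ y
pair⁻ x y z e with ∨-true⁻ (z ≡ᵇ x) e
... | inj₁ z≡x = inj₁ (≡ᵇ≡true⇒≡ z x z≡x)
... | inj₂ z≡y = inj₂ (≡ᵇ≡true⇒≡ z y z≡y)

pairˡ : ∀ x y → pair x y x ≡ true
pairˡ x y = ∨-trueˡ (x ≡ᵇ y) (≡ᵇ-refl x)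

pairʳ : ∀ x y → pair x y y ≡ true
pairʳ x y = ∨-trueʳ (y ≡ᵇ x) (≡ᵇ-refl y)

-- Counting over ranges of ℕ

bool→ℕ : Bool → ℕ
bool→ℕ true  = 1
bool→ℕ false = 0

count : (ℕ → Bool) → ℕ → ℕ → ℕ
count f a zero    = 0
count f a (suc L) = bool→ℕ (f a) + count f (suc a) L

InRange : ℕ → ℕ → ℕ → Set
InRange a L k = a ≤ k × k < a + L

inRange-head : ∀ a L → InRange a (suc L) a
inRange-head a L = ≤-refl , subst (a <_) (sym (+-suc a L)) (s≤s (m≤m+n a L))

inRange-tail : ∀ {a L k} → InRange (suc a) L k → InRange a (suc L) k
inRange-tail {a} {L} {k} (a<k , k<) = <⇒≤ a<k , subst (k <_) (sym (+-suc a L)) k<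

inRange-next : ∀ {a L k} → InRange a (suc L) k → a ≢ k → InRange (suc a) L k
inRange-next {a} {L} {k} (a≤k , k<) a≢k = ≤∧≢⇒< a≤k a≢k , subst (k <_) (+-suc a L) k<

inRange-empty : ∀ {a k} → ¬ InRange a 0 k
inRange-empty {a} {k} (a≤k , k<a+0) = <⇒≱ k<a+0 (subst (_≤ k) (sym (+-identityʳ a)) a≤k)

count-cong : ∀ f g a L → (∀ k → InRange a L k → f k ≡ g k) → count f a L ≡ count g a L
count-cong f g a zero    h = refl
count-cong f g a (suc L) h =
  cong₂ _+_ (cong bool→ℕ (h a (inRange-head a L))) (count-cong f g (suc a) L (λ k → h k ∘ inRange-tail))

count≤length : ∀ f a L → count f a L ≤ L
count≤length f a zero = z≤n
count≤length f a (suc L) with f a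
... | true  = s≤s (count≤length f (suc a) L)
... | false = m≤n⇒m≤1+n (count≤length f (suc a) L)

count-all : ∀ f a L → (∀ k → InRange a L k → f k ≡ true) → count f a L ≡ L
count-all f a zero    h = refl
count-all f a (suc L) h rewrite h a (inRange-head a L) = cong suc (count-all f (suc a) L (λ k → h k ∘ inRange-tail))

count-none : ∀ f a L → (∀ k → InRange a L k → f k ≡ false) → count f a L ≡ 0
count-none f a zero    h = refl
count-none f a (suc L) h rewrite h a (inRange-head a L) = count-none f (suc a) L (λ k → h k ∘ inRange-tail)

count-+ : ∀ f a L₁ L₂ → count f a (L₁ + L₂) ≡ count f a L₁ + count f (a + L₁) L₂
count-+ f a zero     L₂ rewrite +-identityʳ a = refl
count-+ f a (suc L₁) L₂ rewrite count-+ f (suc a) L₁ L₂ | +-suc a L₁ =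
  sym (+-assoc (bool→ℕ (f a)) (count f (suc a) L₁) _)

count-shift : ∀ f k a L → count f (k + a) L ≡ count (λ z → f (k + z)) a L
count-shift f k a zero    = refl
count-shift f k a (suc L) =
  cong (bool→ℕ (f (k + a)) +_) (trans (cong (λ b → count f b L) (sym (+-suc k a))) (count-shift f k (suc a) L))

count-mono : ∀ f g a L → (∀ k → InRange a L k → f k ≡ true → g k ≡ true) → count f a L ≤ count g a L
count-mono f g a zero    h = z≤n
count-mono f g a (suc L) h with f a in fa | g a in ga
... | true  | true  = s≤s (count-mono f g (suc a) L λ k → h k ∘ inRange-tail)
... | true  | false = ⊥-elim (not-¬ (h a (inRange-head a L) fa) ga)
... | false | _     = ≤-trans (count-mono f g (suc a) L λ k → h k ∘ inRange-tail) (m≤n+m _ (bool→ℕ _))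

count-mono-except : ∀ f g a L x → (∀ k → InRange a L k → k ≢ x → f k ≡ true → g k ≡ true) →
                    count f a L ≤ suc (count g a L)
count-mono-except f g a zero    x h = z≤n
count-mono-except f g a (suc L) x h with a ≟ x
... | yes refl = +-mono-≤ (bool→ℕ≤1 (f a)) (≤-trans rest (m≤n+m _ (bool→ℕ (g a))))
  where
  bool→ℕ≤1 : ∀ b → bool→ℕ b ≤ 1
  bool→ℕ≤1 true  = ≤-refl
  bool→ℕ≤1 false = z≤n
  rest : count f (suc a) L ≤ count g (suc a) L
  rest = count-mono f g (suc a) L λ k k∈ → h k (inRange-tail k∈) (>⇒≢ (proj₁ k∈))
... | no a≢x with f a in fa | g a in ga
...   | true  | true  = s≤s (count-mono-except f g (suc a) L x λ k → h k ∘ inRange-tail)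
...   | true  | false = ⊥-elim (not-¬ (h a (inRange-head a L) a≢x fa) ga)
...   | false | _     = ≤-trans (count-mono-except f g (suc a) L x λ k → h k ∘ inRange-tail) (s≤s (m≤n+m _ (bool→ℕ _)))

count<length : ∀ f a L k → InRange a L k → f k ≡ false → count f a L < L
count<length f a zero    k k∈ fk = ⊥-elim (inRange-empty k∈)
count<length f a (suc L) k k∈ fk with a ≟ k
... | yes refl rewrite fk = s≤s (count≤length f (suc a) L)
... | no a≢k with f a
...   | true  = s≤s (count<length f (suc a) L k (inRange-next k∈ a≢k) fk)
...   | false = m≤n⇒m≤1+n (count<length f (suc a) L k (inRange-next k∈ a≢k) fk)

1≤count : ∀ f a L k → InRange a L k → f k ≡ true → 1 ≤ count f a L
1≤count f a zero    k k∈ fk = ⊥-elim (inRange-empty k∈)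
1≤count f a (suc L) k k∈ fk with a ≟ k
... | yes refl rewrite fk = s≤s z≤n
... | no a≢k = ≤-trans (1≤count f (suc a) L k (inRange-next k∈ a≢k) fk) (m≤n+m _ (bool→ℕ (f a)))

2≤count : ∀ f a L x y → InRange a L x → InRange a L y → x ≢ y → f x ≡ true → f y ≡ true → 2 ≤ count f a L
2≤count f a zero    x y x∈ y∈ x≢y fx fy = ⊥-elim (inRange-empty x∈)
2≤count f a (suc L) x y x∈ y∈ x≢y fx fy with a ≟ x | a ≟ y
... | yes refl | _        rewrite fx = s≤s (1≤count f (suc a) L y (inRange-next y∈ x≢y) fy)
... | no _     | yes refl rewrite fy = s≤s (1≤count f (suc a) L x (inRange-next x∈ (x≢y ∘ sym)) fx)
... | no a≢x   | no a≢y   =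
  ≤-trans (2≤count f (suc a) L x y (inRange-next x∈ a≢x) (inRange-next y∈ a≢y) x≢y fx fy) (m≤n+m _ (bool→ℕ (f a)))

count≡1 : ∀ f a L x → InRange a L x → f x ≡ true → (∀ k → InRange a L k → k ≢ x → f k ≡ false) → count f a L ≡ 1
count≡1 f a zero    x x∈ fx h = ⊥-elim (inRange-empty x∈)
count≡1 f a (suc L) x x∈ fx h with a ≟ x
... | yes refl rewrite fx = cong suc (count-none f (suc a) L λ k k∈ → h k (inRange-tail k∈) (>⇒≢ (proj₁ k∈)))
... | no a≢x rewrite h a (inRange-head a L) a≢x = count≡1 f (suc a) L x (inRange-next x∈ a≢x) fx λ k → h k ∘ inRange-tail

count-allBut : ∀ a L x → InRange a L x → suc (count (λ k → not (k ≡ᵇ x)) a L) ≡ L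
count-allBut a L x x∈ = ≤-antisym
  (count<length _ a L x x∈ (cong not (≡ᵇ-refl x)))
  (subst (_≤ suc (count _ a L)) (count-all (λ _ → true) a L λ _ _ → refl)
    (count-mono-except (λ _ → true) _ a L x λ k _ k≢x _ → cong not (≢⇒≡ᵇ≡false k x k≢x)))

count-≡ᵇ≤1 : ∀ x a L → count (_≡ᵇ x) a L ≤ 1
count-≡ᵇ≤1 x a L = subst (λ c → count (_≡ᵇ x) a L ≤ suc c) (count-none (λ _ → false) a L λ _ _ → refl)
  (count-mono-except _ (λ _ → false) a L x λ k _ k≢x k≡x → ⊥-elim (k≢x (≡ᵇ≡true⇒≡ k x k≡x)))

count-pair≤2 : ∀ x y a L → count (pair x y) a L ≤ 2
count-pair≤2 x y a L = ≤-trans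
  (count-mono-except (pair x y) (_≡ᵇ y) a L x λ k _ k≢x e → case pair⁻ x y k e of λ where
    (inj₁ k≡x)  → ⊥-elim (k≢x k≡x)
    (inj₂ refl) → ≡ᵇ-refl k)
  (s≤s (count-≡ᵇ≤1 y a L))

count-pair : ∀ x y a L → InRange a L x → InRange a L y → x ≢ y → count (pair x y) a L ≡ 2
count-pair x y a L x∈ y∈ x≢y = ≤-antisym (count-pair≤2 x y a L) (2≤count _ a L x y x∈ y∈ x≢y (pairˡ x y) (pairʳ x y))

count-≡ᵇ : ∀ x a L → InRange a L x → count (_≡ᵇ x) a L ≡ 1
count-≡ᵇ x a L x∈ = count≡1 _ a L x x∈ (≡ᵇ-refl x) λ k _ k≢x → ≢⇒≡ᵇ≡false k x k≢x

⌈suc/2⌉≤suc⌈/2⌉ : ∀ L → ⌈ suc L /2⌉ ≤ suc ⌈ L /2⌉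
⌈suc/2⌉≤suc⌈/2⌉ L = s≤s (⌊n/2⌋≤⌈n/2⌉ L)

count-noAdjacent : ∀ f a L → (∀ k → InRange a L k → InRange a L (suc k) → f k ≡ true → f (suc k) ≡ false) →
                   count f a L ≤ ⌈ L /2⌉
count-noAdjacent f a zero          h = z≤n
count-noAdjacent f a (suc zero)    h with f a
... | true  = ≤-refl
... | false = z≤n
count-noAdjacent f a (suc (suc L)) h =
  bound (f a) refl (count-noAdjacent f (suc (suc a)) L λ k k∈ k+1∈ → h k (twice k∈) (twice k+1∈))
                   (count-noAdjacent f (suc a) (suc L) λ k k∈ k+1∈ → h k (inRange-tail k∈) (inRange-tail k+1∈))
  where
  twice : ∀ {k} → InRange (suc (suc a)) L k → InRange a (suc (suc L)) k
  twice = inRange-tail ∘ inRange-tail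
  bound : ∀ b → f a ≡ b → count f (suc (suc a)) L ≤ ⌈ L /2⌉ → count f (suc a) (suc L) ≤ ⌈ suc L /2⌉ →
          bool→ℕ b + count f (suc a) (suc L) ≤ suc ⌈ L /2⌉
  bound true  fa from-a+2 _ rewrite h a (inRange-head a (suc L)) (inRange-tail (inRange-head (suc a) L)) fa = s≤s from-a+2
  bound false _  _ from-a+1 = ≤-trans from-a+1 (⌈suc/2⌉≤suc⌈/2⌉ L)

even : ℕ → Bool
even zero    = true
even (suc k) = not (even k)

even-double : ∀ k → even (k + k) ≡ true
even-double zero    = refl
even-double (suc k) rewrite +-suc k k = trans (not-involutive (even (k + k))) (even-double k)

count-even : ∀ k a → even a ≡ true → count even a (k + k) ≡ k
count-even zero    a _     = refl
count-even (suc k) a evena rewrite +-suc k k | evena =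
  cong suc (count-even k (suc (suc a)) (trans (not-involutive (even a)) evena))

search : ∀ (f : ℕ → Bool) a L → (∃ λ k → InRange a L k × f k ≡ true) ⊎ (∀ k → InRange a L k → f k ≡ false)
search f a zero    = inj₂ λ k k∈ → ⊥-elim (inRange-empty k∈)
search f a (suc L) with f a in fa
... | true  = inj₁ (a , inRange-head a L , fa)
... | false with search f (suc a) L
...   | inj₁ (k , k∈ , fk) = inj₁ (k , inRange-tail k∈ , fk)
...   | inj₂ none          = inj₂ λ k k∈ → case a ≟ k of λ where
  (yes refl) → fa
  (no a≢k)   → none k (inRange-next k∈ a≢k)

-- Subsets of Fin n as Boolean predicates on ℕ

χ : ∀ {n} → Subset n → ℕ → Bool
χ []      _       = false
χ (b ∷ p) zero    = b
χ (b ∷ p) (suc k) = χ p k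

∈⇒χ : ∀ {n} {x : Fin n} {p : Subset n} → x ∈ p → χ p (toℕ x) ≡ true
∈⇒χ here      = refl
∈⇒χ (there x∈p) = ∈⇒χ x∈p

χ⇒∈ : ∀ {n} (x : Fin n) (p : Subset n) → χ p (toℕ x) ≡ true → x ∈ p
χ⇒∈ fzero    (true ∷ p) _ = here
χ⇒∈ (fsuc x) (_ ∷ p)    e = there (χ⇒∈ x p e)

∉⇒χ : ∀ {n} (x : Fin n) (p : Subset n) → x ∉ p → χ p (toℕ x) ≡ false
∉⇒χ x p x∉p = ¬-not (x∉p ∘ χ⇒∈ x p)

χ⇒∉ : ∀ {n} (x : Fin n) (p : Subset n) → χ p (toℕ x) ≡ false → x ∉ p
χ⇒∉ x p e x∈p = not-¬ (∈⇒χ x∈p) e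

∣p∣≡count-χ : ∀ {n} (p : Subset n) → ∣ p ∣ ≡ count (χ p) 0 n
∣p∣≡count-χ []               = refl
∣p∣≡count-χ {suc n} (true ∷ p)  = cong suc (trans (∣p∣≡count-χ p) (sym (count-shift (χ (true ∷ p)) 1 0 n)))
∣p∣≡count-χ {suc n} (false ∷ p) = trans (∣p∣≡count-χ p) (sym (count-shift (χ (false ∷ p)) 1 0 n))

χ-∩ : ∀ {n} (p q : Subset n) k → χ (p ∩ q) k ≡ (χ p k ∧ χ q k)
χ-∩ []      []      k       = refl
χ-∩ (a ∷ p) (b ∷ q) zero    = refl
χ-∩ (a ∷ p) (b ∷ q) (suc k) = χ-∩ p q k

χ-∅ : ∀ {n} k → χ (∅ {n}) k ≡ false
χ-∅ {zero}  k       = refl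
χ-∅ {suc n} zero    = refl
χ-∅ {suc n} (suc k) = χ-∅ {n} k

χ-⁅⁆ : ∀ {n} (x : Fin n) k → χ ⁅ x ⁆ k ≡ (k ≡ᵇ toℕ x)
χ-⁅⁆ fzero             zero    = refl
χ-⁅⁆ {suc n} fzero     (suc k) = χ-∅ {n} k
χ-⁅⁆ (fsuc x)          zero    = refl
χ-⁅⁆ (fsuc x)          (suc k) = χ-⁅⁆ x k

χ-ext : ∀ {n} (p q : Subset n) → (∀ k → k < n → χ p k ≡ χ q k) → p ≡ q
χ-ext []      []      h = refl
χ-ext (a ∷ p) (b ∷ q) h = cong₂ _∷_ (h 0 z<s) (χ-ext p q λ k k<n → h (suc k) (s<s k<n))

⟦_⟧ : ∀ {n} → (ℕ → Bool) → Subset n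
⟦ φ ⟧ = tabulate (φ ∘ toℕ)

χ-⟦⟧ : ∀ {n} (φ : ℕ → Bool) k → k < n → χ (⟦_⟧ {n} φ) k ≡ φ k
χ-⟦⟧ {suc n} φ zero    _         = refl
χ-⟦⟧ {suc n} φ (suc k) (s≤s k<n) = χ-⟦⟧ {n} (φ ∘ suc) k k<n

∈⟦⟧⁺ : ∀ {n} (φ : ℕ → Bool) (x : Fin n) → φ (toℕ x) ≡ true → x ∈ ⟦ φ ⟧
∈⟦⟧⁺ φ x e = χ⇒∈ x ⟦ φ ⟧ (trans (χ-⟦⟧ φ (toℕ x) (toℕ<n x)) e)

∈⟦⟧⁻ : ∀ {n} (φ : ℕ → Bool) (x : Fin n) → x ∈ ⟦ φ ⟧ → φ (toℕ x) ≡ true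
∈⟦⟧⁻ φ x x∈ = trans (sym (χ-⟦⟧ φ (toℕ x) (toℕ<n x))) (∈⇒χ x∈)

∣⟦⟧∣ : ∀ {n} (φ : ℕ → Bool) → ∣ ⟦_⟧ {n} φ ∣ ≡ count φ 0 n
∣⟦⟧∣ {n} φ = trans (∣p∣≡count-χ (⟦_⟧ {n} φ)) (count-cong _ _ 0 n λ k (_ , k<n) → χ-⟦⟧ φ k k<n)

⊆⇒χ : ∀ {n} {p q : Subset n} → p ⊆ q → ∀ k → k < n → χ p k ≡ true → χ q k ≡ true
⊆⇒χ {p = p} {q} p⊆q k k<n e = subst (λ j → χ q j ≡ true) (toℕ-fromℕ< k<n)
  (∈⇒χ (p⊆q (χ⇒∈ (fromℕ< k<n) p (trans (cong (χ p) (toℕ-fromℕ< k<n)) e))))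

χ⇒⊆ : ∀ {n} (p q : Subset n) → (∀ k → k < n → χ p k ≡ true → χ q k ≡ true) → p ⊆ q
χ⇒⊆ p q h {x} x∈p = χ⇒∈ x q (h (toℕ x) (toℕ<n x) (∈⇒χ x∈p))

⊂⇒χ-witness : ∀ {n} {p q : Subset n} → p ⊂ q → ∃ λ z → z < n × χ q z ≡ true × χ p z ≡ false
⊂⇒χ-witness {p = p} (_ , z , z∈q , z∉p) = toℕ z , toℕ<n z , ∈⇒χ z∈q , ∉⇒χ z p z∉p

χ⇒⊂ : ∀ {n} (p q : Subset n) → (∀ k → k < n → χ p k ≡ true → χ q k ≡ true) →
      ∀ z → z < n → χ q z ≡ true → χ p z ≡ false → p ⊂ q
χ⇒⊂ p q h z z<n qz pz = χ⇒⊆ p q h , fromℕ< z<n ,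
  χ⇒∈ _ q (trans (cong (χ q) (toℕ-fromℕ< z<n)) qz) , χ⇒∉ _ p (trans (cong (χ p) (toℕ-fromℕ< z<n)) pz)

-- Forts and zero forcing in an arbitrary graph

module _ {n : ℕ} (G : Graph n) where

  ∈N⁺ : ∀ {v x} → G v x ≡ true → x ∈ N G v
  ∈N⁺ {v} {x} e = lookup⇒[]= x (tabulate (G v)) (trans (lookup∘tabulate (G v) x) e)

  ∈N⁻ : ∀ {v x} → x ∈ N G v → G v x ≡ true
  ∈N⁻ {v} {x} x∈N = trans (sym (lookup∘tabulate (G v) x)) ([]=⇒lookup x∈N)

  NoNeighbourIn : Subset n → Fin n → Set
  NoNeighbourIn F v = ∀ x → G v x ≡ true → x ∉ F

  TwoNeighboursIn : Subset n → Fin n → Set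
  TwoNeighboursIn F v = ∃₂ λ x y → x ≢ y × (x ∈ F × G v x ≡ true) × (y ∈ F × G v y ≡ true)

  isFort-intro : ∀ {F} → Nonempty F → (∀ v → v ∉ F → NoNeighbourIn F v ⊎ TwoNeighboursIn F v) → IsFort G F
  isFort-intro {F} nonempty outside = nonempty , λ v v∉F → [ none v , two v ]′ (outside v v∉F)
    where
    none : ∀ v → NoNeighbourIn F v → ∣ F ∩ N G v ∣ ≢ 1
    none v h ∣F∩N∣≡1 = 0≢1+n (trans (sym (∣⊥∣≡0 n)) (trans (cong ∣_∣ (sym F∩N≡∅)) ∣F∩N∣≡1))
      where
      F∩N≡∅ : F ∩ N G v ≡ ∅
      F∩N≡∅ = Empty-unique λ (x , x∈) → let (x∈F , x∈N) = x∈p∩q⁻ F (N G v) x∈ in h x (∈N⁻ x∈N) x∈F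
    two : ∀ v → TwoNeighboursIn F v → ∣ F ∩ N G v ∣ ≢ 1
    two v (x , y , x≢y , (x∈F , vx) , (y∈F , vy)) ∣F∩N∣≡1 =
      <⇒≢ (subst (2 ≤_) (sym (∣p∣≡count-χ (F ∩ N G v)))
             (2≤count _ 0 n (toℕ x) (toℕ y) (z≤n , toℕ<n x) (z≤n , toℕ<n y) (x≢y ∘ toℕ-injective)
                (∈⇒χ (x∈p∩q⁺ (x∈F , ∈N⁺ vx))) (∈⇒χ (x∈p∩q⁺ (y∈F , ∈N⁺ vy)))))
          (sym ∣F∩N∣≡1)

  fort-soleNeighbour : ∀ {F v w} → IsFort G F → v ∉ F → w ∈ F → G v w ≡ true →
                       (∀ z → G v z ≡ true → z ≢ w → z ∉ F) → Empty
  fort-soleNeighbour {F} {v} {w} (_ , fort) v∉F w∈F vw others =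
    fort v v∉F (trans (cong ∣_∣ F∩N≡⁅w⁆) (∣⁅x⁆∣≡1 w))
    where
    F∩N≡⁅w⁆ : F ∩ N G v ≡ ⁅ w ⁆
    F∩N≡⁅w⁆ = ⊆-antisym
      (λ {z} z∈ → let (z∈F , z∈N) = x∈p∩q⁻ F (N G v) z∈ in case z ≟ᶠ w of λ where
         (yes refl) → x∈⁅x⁆ w
         (no z≢w)   → ⊥-elim (others z (∈N⁻ z∈N) z≢w z∈F))
      (λ {z} z∈⁅w⁆ → subst (λ x → x ∈ F ∩ N G v) (sym (x∈⁅y⁆⇒x≡y w z∈⁅w⁆)) (x∈p∩q⁺ (w∈F , ∈N⁺ vw)))

  ZFReaches-mono : ∀ {B B′} → ZFReaches G B → B ⊆ B′ → ZFReaches G B′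
  ZFReaches-mono (done all) B⊆B′ = done (B⊆B′ ∘ all)
  ZFReaches-mono {B} {B′} (force u w u∈B w∉B uw others rest) B⊆B′ with w ∈? B′
  ... | yes w∈B′ = ZFReaches-mono rest λ {x} x∈ → [ (λ x∈⁅w⁆ → subst (_∈ B′) (sym (x∈⁅y⁆⇒x≡y w x∈⁅w⁆)) w∈B′) , B⊆B′ ]′
                                                   (x∈p∪q⁻ ⁅ w ⁆ B x∈)
  ... | no w∉B′  = force u w (B⊆B′ u∈B) w∉B′ uw (λ v uv v≢w → B⊆B′ (others v uv v≢w))
                     (ZFReaches-mono rest λ {x} x∈ → x∈p∪q⁺ ([ inj₁ , inj₂ ∘ B⊆B′ ]′ (x∈p∪q⁻ ⁅ w ⁆ B x∈)))

  -- The first force into a fort is impossible: its forcing vertex would have a sole neighbour in the fort.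
  ZFReaches-meets-fort : ∀ {B F} → ZFReaches G B → IsFort G F → ∃ λ x → x ∈ B × x ∈ F
  ZFReaches-meets-fort (done all) ((x , x∈F) , _) = x , all x , x∈F
  ZFReaches-meets-fort {B} {F} (force u w u∈B w∉B uw others rest) isFort
    with ZFReaches-meets-fort rest isFort
  ... | x , x∈⁅w⁆∪B , x∈F with x∈p∪q⁻ ⁅ w ⁆ B x∈⁅w⁆∪B
  ...   | inj₂ x∈B = x , x∈B , x∈F
  ...   | inj₁ x∈⁅w⁆ with u ∈? F | any? (λ z → (z ∈? B) ×-dec (z ∈? F))
  ...     | yes u∈F | _           = u , u∈B , u∈F
  ...     | no _    | yes found   = found
  ...     | no u∉F  | no nowhere  = ⊥-elim (fort-soleNeighbour isFort u∉F w∈F uw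
                                      λ z uz z≢w z∈F → nowhere (z , others z uz z≢w , z∈F))
    where
    w∈F : w ∈ F
    w∈F = subst (_∈ F) (x∈⁅y⁆⇒x≡y w x∈⁅w⁆) x∈F

module ℕAdjacency (n : ℕ) (adj : ℕ → ℕ → Bool) where

  G : Graph n
  G i j = adj (toℕ i) (toℕ j)

  toℕ-fromℕ<-adjˡ : ∀ {v} (v<n : v < n) z → adj (toℕ (fromℕ< v<n)) z ≡ adj v z
  toℕ-fromℕ<-adjˡ v<n z = cong (λ a → adj a z) (toℕ-fromℕ< v<n)

  ZeroOrTwoNeighboursIn : (ℕ → Bool) → ℕ → Set
  ZeroOrTwoNeighboursIn φ v =
    (∀ z → z < n → adj v z ≡ true → φ z ≡ false) ⊎
    (∃₂ λ a b → a < n × b < n × a ≢ b × (φ a ≡ true × adj v a ≡ true) × (φ b ≡ true × adj v b ≡ true))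

  isFortᴺ-intro : ∀ φ v₀ → v₀ < n → φ v₀ ≡ true → (∀ v → v < n → φ v ≡ false → ZeroOrTwoNeighboursIn φ v) →
                  IsFort G ⟦ φ ⟧
  isFortᴺ-intro φ v₀ v₀<n φv₀ outside =
    isFort-intro G (fromℕ< v₀<n , ∈⟦⟧⁺ φ _ (trans (cong φ (toℕ-fromℕ< v₀<n)) φv₀)) λ v v∉F →
      case outside (toℕ v) (toℕ<n v) (trans (sym (χ-⟦⟧ φ (toℕ v) (toℕ<n v))) (∉⇒χ v ⟦ φ ⟧ v∉F)) of λ where
        (inj₁ none) → inj₁ λ x vx x∈F → not-¬ (∈⟦⟧⁻ φ x x∈F) (none (toℕ x) (toℕ<n x) vx)
        (inj₂ (a , b , a<n , b<n , a≢b , (φa , va) , (φb , vb))) →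
          inj₂ (fromℕ< a<n , fromℕ< b<n , (λ e → a≢b (trans (sym (toℕ-fromℕ< a<n)) (trans (cong toℕ e) (toℕ-fromℕ< b<n)))) ,
                (inF a<n φa , trans (cong (adj (toℕ v)) (toℕ-fromℕ< a<n)) va) ,
                (inF b<n φb , trans (cong (adj (toℕ v)) (toℕ-fromℕ< b<n)) vb))
    where
    inF : ∀ {a} (a<n : a < n) → φ a ≡ true → fromℕ< a<n ∈ ⟦ φ ⟧
    inF a<n φa = ∈⟦⟧⁺ φ _ (trans (cong φ (toℕ-fromℕ< a<n)) φa)

  fortᴺ-soleNeighbour : ∀ {F} → IsFort G F → ∀ {v a} → v < n → χ F v ≡ false → a < n → χ F a ≡ true → adj v a ≡ true →
                        (∀ z → z < n → z ≢ a → adj v z ≡ true → χ F z ≡ false) → Empty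
  fortᴺ-soleNeighbour {F} isFort {v} {a} v<n Fv a<n Fa va others =
    fort-soleNeighbour G isFort
      (χ⇒∉ _ F (trans (cong (χ F) (toℕ-fromℕ< v<n)) Fv))
      (χ⇒∈ _ F (trans (cong (χ F) (toℕ-fromℕ< a<n)) Fa))
      (subst₂ (λ x y → adj x y ≡ true) (sym (toℕ-fromℕ< v<n)) (sym (toℕ-fromℕ< a<n)) va)
      λ z vz z≢a z∈F → not-¬ (∈⇒χ z∈F)
        (others (toℕ z) (toℕ<n z) (λ e → z≢a (toℕ-injective (trans e (sym (toℕ-fromℕ< a<n)))))
                (trans (sym (toℕ-fromℕ<-adjˡ v<n (toℕ z))) vz))

  Reaches : (ℕ → Bool) → Set
  Reaches φ = ZFReaches G ⟦ φ ⟧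

  reaches-mono : ∀ φ ψ → Reaches φ → (∀ v → v < n → φ v ≡ true → ψ v ≡ true) → Reaches ψ
  reaches-mono φ ψ R φ⇒ψ = ZFReaches-mono G R λ {x} x∈ → ∈⟦⟧⁺ ψ x (φ⇒ψ (toℕ x) (toℕ<n x) (∈⟦⟧⁻ φ x x∈))

  reaches-done : ∀ φ → (∀ v → v < n → φ v ≡ true) → Reaches φ
  reaches-done φ all = done λ v → ∈⟦⟧⁺ φ v (all (toℕ v) (toℕ<n v))

  reaches-force : ∀ φ u w → u < n → w < n → φ u ≡ true → adj u w ≡ true →
                  (∀ v → v < n → adj u v ≡ true → v ≢ w → φ v ≡ true) →
                  Reaches (λ z → φ z ∨ (z ≡ᵇ w)) → Reaches φ
  reaches-force φ u w u<n w<n φu uw others rest with fromℕ< w<n ∈? ⟦ φ ⟧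
  ... | yes w∈ = reaches-mono _ φ rest λ v v<n e → case ∨-true⁻ (φ v) e of λ where
        (inj₁ φv)  → φv
        (inj₂ v≡w) → subst (λ z → φ z ≡ true) (trans (toℕ-fromℕ< w<n) (sym (≡ᵇ≡true⇒≡ v w v≡w))) (∈⟦⟧⁻ φ _ w∈)
  ... | no w∉ = force (fromℕ< u<n) (fromℕ< w<n) (∈⟦⟧⁺ φ _ (trans (cong φ (toℕ-fromℕ< u<n)) φu)) w∉
        (subst₂ (λ a b → adj a b ≡ true) (sym (toℕ-fromℕ< u<n)) (sym (toℕ-fromℕ< w<n)) uw)
        (λ v uv v≢w → ∈⟦⟧⁺ φ v (others (toℕ v) (toℕ<n v) (trans (sym (toℕ-fromℕ<-adjˡ u<n (toℕ v))) uv)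
                                  λ e → v≢w (toℕ-injective (trans e (sym (toℕ-fromℕ< w<n))))))
        (ZFReaches-mono G rest λ {x} x∈ → case ∨-true⁻ (φ (toℕ x)) (∈⟦⟧⁻ (λ z → φ z ∨ (z ≡ᵇ w)) x x∈) of λ where
          (inj₁ φx)  → x∈p∪q⁺ (inj₂ (∈⟦⟧⁺ φ x φx))
          (inj₂ x≡w) → x∈p∪q⁺ (inj₁ (subst (_∈ ⁅ fromℕ< w<n ⁆)
                          (sym (toℕ-injective (trans (≡ᵇ≡true⇒≡ _ w x≡w) (sym (toℕ-fromℕ< w<n))))) (x∈⁅x⁆ _))))

  reaches-meets-fort : ∀ {B} → ZFReaches G B → ∀ φ → IsFort G ⟦ φ ⟧ → ∃ λ k → k < n × χ B k ≡ true × φ k ≡ true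
  reaches-meets-fort R φ isFort with ZFReaches-meets-fort G R isFort
  ... | x , x∈B , x∈F = toℕ x , toℕ<n x , ∈⇒χ x∈B , ∈⟦⟧⁻ φ x x∈F

  ¬reaches-outside-fort : ∀ S φ → IsFort G ⟦ φ ⟧ → (∀ k → k < n → χ S k ≡ true → φ k ≡ false) → ¬ ZFReaches G S
  ¬reaches-outside-fort S φ isFort disjoint R with reaches-meets-fort R φ isFort
  ... | k , k<n , Sk , φk = not-¬ φk (disjoint k k<n Sk)

  Private : Subset n → ℕ → (ℕ → Bool) → Set
  Private S x φ = φ x ≡ true × (∀ k → k < n → k ≢ x → χ S k ≡ true → φ k ≡ false)

  maximalZIr-⊄ : ∀ {S} → IsMaximalZIr G S → ∀ φ → IsZIr G ⟦ φ ⟧ → (∀ k → k < n → χ S k ≡ true → φ k ≡ true) →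
                 ∀ z → z < n → φ z ≡ true → χ S z ≡ false → Empty
  maximalZIr-⊄ {S} (_ , maximal) φ zirφ S⊆φ z z<n φz Sz =
    maximal ⟦ φ ⟧ (χ⇒⊂ S ⟦ φ ⟧ (λ k k<n Sk → trans (χ-⟦⟧ φ k k<n) (S⊆φ k k<n Sk)) z z<n (trans (χ-⟦⟧ φ z z<n) φz) Sz) zirφ

  private-in-pair : ∀ a b x φ → φ x ≡ true → (∀ k → k ≢ x → k ≡ a ⊎ k ≡ b → φ k ≡ false) → Private ⟦ pair a b ⟧ x φ
  private-in-pair a b x φ φx others = φx , λ k k<n k≢x k∈ → others k k≢x (pair⁻ a b k (trans (sym (χ-⟦⟧ (pair a b) k k<n)) k∈))

  privateFort : ∀ {S} → IsZIr G S → ∀ {x} → x < n → χ S x ≡ true → ∃ λ F → IsFort G F × Private S x (χ F)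
  privateFort {S} zir {x} x<n Sx with zir (fromℕ< x<n) (χ⇒∈ _ S (trans (cong (χ S) (toℕ-fromℕ< x<n)) Sx))
  ... | F , isFort , S∩F≡⁅x⁆ = F , isFort , inF (≡ᵇ-refl x) Sx , λ k _ k≢x Sk → inF (≢⇒≡ᵇ≡false k x k≢x) Sk
    where
    S∧F : ∀ k → (χ S k ∧ χ F k) ≡ (k ≡ᵇ x)
    S∧F k = trans (sym (χ-∩ S F k)) (trans (cong (λ p → χ p k) S∩F≡⁅x⁆)
              (trans (χ-⁅⁆ (fromℕ< x<n) k) (cong (k ≡ᵇ_) (toℕ-fromℕ< x<n))))
    inF : ∀ {k b} → (k ≡ᵇ x) ≡ b → χ S k ≡ true → χ F k ≡ b
    inF {k} eq Sk = trans (sym (cong (_∧ χ F k) Sk)) (trans (S∧F k) eq)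

  isZIr-intro : ∀ S → (∀ x → x < n → χ S x ≡ true → ∃ λ φ → IsFort G ⟦ φ ⟧ × Private S x φ) → IsZIr G S
  isZIr-intro S hasPrivate x x∈S with hasPrivate (toℕ x) (toℕ<n x) (∈⇒χ x∈S)
  ... | φ , isFort , φx , φ-avoids = ⟦ φ ⟧ , isFort , χ-ext (S ∩ ⟦ φ ⟧) ⁅ x ⁆ λ k k<n →
    trans (χ-∩ S ⟦ φ ⟧ k) (trans (cong (χ S k ∧_) (χ-⟦⟧ φ k k<n)) (trans (S∧φ k k<n) (sym (χ-⁅⁆ x k))))
    where
    S∧φ : ∀ k → k < n → (χ S k ∧ φ k) ≡ (k ≡ᵇ toℕ x)
    S∧φ k k<n with k ≟ toℕ x
    ... | yes refl rewrite ∈⇒χ x∈S | φx = sym (≡ᵇ-refl k)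
    ... | no k≢x rewrite ≢⇒≡ᵇ≡false k (toℕ x) k≢x with χ S k in Sk
    ...   | true  = φ-avoids k k<n k≢x Sk
    ...   | false = refl

-- In H(r,s), u = 0, wᵢ = i and yⱼ = r + j; thus y₁ = suc r and yₛ = u′ = r + s.

module Structure (r s : ℕ) (r≥2 : 2 ≤ r) (s≥3 : 3 ≤ s) where

  n : ℕ
  n = r + s + 1

  adj : ℕ → ℕ → Bool
  adj a b = Hedge r s a b ∨ Hedge r s b a

  open ℕAdjacency n adj public

  data Edge (a b : ℕ) : Set where
    uw  : a ≡ 0 → 1 ≤ b → b ≤ r → Edge a b
    wyₛ : 1 ≤ a → a ≤ r → b ≡ r + s → Edge a b
    yy  : suc r ≤ a → b ≡ suc a → b ≤ r + s → Edge a b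

  Hedge⇒Edge : ∀ a b → Hedge r s a b ≡ true → Edge a b
  Hedge⇒Edge a b e with ∨-true⁻ _ e
  ... | inj₁ e₁ with ∧-true⁻ (a ≡ᵇ 0) e₁
  ...   | a≡0 , e₂ with ∧-true⁻ (1 ≤ᵇ b) e₂
  ...     | 1≤b , b≤r = uw (≡ᵇ≡true⇒≡ a 0 a≡0) (≤ᵇ≡true⇒≤ 1 b 1≤b) (≤ᵇ≡true⇒≤ b r b≤r)
  Hedge⇒Edge a b e | inj₂ e₁ with ∨-true⁻ _ e₁
  ... | inj₁ e₂ with ∧-true⁻ (1 ≤ᵇ a) e₂
  ...   | 1≤a , e₃ with ∧-true⁻ (a ≤ᵇ r) e₃
  ...     | a≤r , b≡ = wyₛ (≤ᵇ≡true⇒≤ 1 a 1≤a) (≤ᵇ≡true⇒≤ a r a≤r) (≡ᵇ≡true⇒≡ b (r + s) b≡)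
  Hedge⇒Edge a b e | inj₂ e₁ | inj₂ e₂ with ∧-true⁻ (suc r ≤ᵇ a) e₂
  ... | r<a , e₃ with ∧-true⁻ (b ≡ᵇ suc a) e₃
  ...   | b≡ , b≤ = yy (≤ᵇ≡true⇒≤ (suc r) a r<a) (≡ᵇ≡true⇒≡ b (suc a) b≡) (≤ᵇ≡true⇒≤ b (r + s) b≤)

  Edge⇒Hedge : ∀ a b → Edge a b → Hedge r s a b ≡ true
  Edge⇒Hedge a b (uw a≡0 1≤b b≤r)
    rewrite ≡⇒≡ᵇ≡true a 0 a≡0 | ≤⇒≤ᵇ≡true 1≤b | ≤⇒≤ᵇ≡true b≤r = refl
  Edge⇒Hedge a b (wyₛ 1≤a a≤r b≡)
    rewrite ≤⇒≤ᵇ≡true 1≤a | ≤⇒≤ᵇ≡true a≤r | ≡⇒≡ᵇ≡true b (r + s) b≡ = ∨-trueʳ _ refl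
  Edge⇒Hedge a b (yy r<a b≡ b≤)
    rewrite ≤⇒≤ᵇ≡true r<a | ≡⇒≡ᵇ≡true b (suc a) b≡ | ≤⇒≤ᵇ≡true b≤ =
      ∨-trueʳ ((a ≡ᵇ 0) ∧ (1 ≤ᵇ b) ∧ (b ≤ᵇ r)) (∨-trueʳ ((1 ≤ᵇ a) ∧ (a ≤ᵇ r) ∧ (b ≡ᵇ r + s)) refl)

  adj⇒Edge : ∀ a b → adj a b ≡ true → Edge a b ⊎ Edge b a
  adj⇒Edge a b e with ∨-true⁻ (Hedge r s a b) e
  ... | inj₁ ab = inj₁ (Hedge⇒Edge a b ab)
  ... | inj₂ ba = inj₂ (Hedge⇒Edge b a ba)

  Edge⇒adj : ∀ {a b} → Edge a b → adj a b ≡ true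
  Edge⇒adj {a} {b} ab = ∨-trueˡ (Hedge r s b a) (Edge⇒Hedge a b ab)

  Edge⇒adjᵒ : ∀ {a b} → Edge b a → adj a b ≡ true
  Edge⇒adjᵒ {a} {b} ba = ∨-trueʳ (Hedge r s a b) (Edge⇒Hedge b a ba)

  r≥1 : 1 ≤ r
  r≥1 = ≤-trans (s≤s z≤n) r≥2

  y₁≤yₛ : suc r ≤ r + s
  y₁≤yₛ = subst (_≤ r + s) (+-comm r 1) (+-monoʳ-≤ r (≤-trans (s≤s z≤n) s≥3))

  y₂<yₛ : suc (suc r) < r + s
  y₂<yₛ = subst (_≤ r + s) (+-comm r 3) (+-monoʳ-≤ r s≥3)

  y₂≤yₛ : suc (suc r) ≤ r + s
  y₂≤yₛ = <⇒≤ y₂<yₛ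

  adjacentInner⇒s≥4 : ∀ a → suc (suc r) ≤ a → suc (suc a) ≤ r + s → 4 ≤ s
  adjacentInner⇒s≥4 a y₁<a a+1<yₛ = +-cancelˡ-≤ r 4 s (subst (_≤ r + s) (+-comm 4 r) (≤-trans (s≤s (s≤s y₁<a)) a+1<yₛ))

  <n : ∀ {v} → v ≤ r + s → v < n
  <n {v} v≤ = subst (v <_) (+-comm 1 (r + s)) (s≤s v≤)

  w<n : ∀ {v} → v ≤ r → v < n
  w<n v≤r = <n (≤-trans v≤r (m≤m+n r s))

  yₛ≢0 : r + s ≢ 0
  yₛ≢0 e = <⇒≢ (≤-trans z<s y₁≤yₛ) (sym e)

  data Region (v : ℕ) : Set where
    atU : v ≡ 0 → Region v
    inW : 1 ≤ v → v ≤ r → Region v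
    onP : suc r ≤ v → v ≤ r + s → Region v

  region : ∀ v → v < n → Region v
  region zero    _   = atU refl
  region (suc v) v<n with suc v ≤? r
  ... | yes v<r = inW (s≤s z≤n) v<r
  ... | no  v≮r = onP (≰⇒> v≮r) (≤-pred (subst (suc v <_) (+-comm (r + s) 1) v<n))

  u-neighbour : ∀ z → adj 0 z ≡ true → 1 ≤ z × z ≤ r
  u-neighbour z e with adj⇒Edge 0 z e
  ... | inj₁ (uw _ 1≤z z≤r) = 1≤z , z≤r
  ... | inj₂ (wyₛ _ _ 0≡)   = ⊥-elim (yₛ≢0 (sym 0≡))
  ... | inj₂ (yy _ () _)

  w-neighbour : ∀ a z → 1 ≤ a → a ≤ r → adj a z ≡ true → z ≡ 0 ⊎ z ≡ r + s
  w-neighbour a z 1≤a a≤r e with adj⇒Edge a z e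
  ... | inj₁ (uw refl _ _)   = case 1≤a of λ ()
  ... | inj₁ (wyₛ _ _ z≡)    = inj₂ z≡
  ... | inj₁ (yy r<a _ _)    = ⊥-elim (<⇒≱ r<a a≤r)
  ... | inj₂ (uw z≡ _ _)     = inj₁ z≡
  ... | inj₂ (wyₛ _ _ a≡)    = ⊥-elim (<⇒≱ y₁≤yₛ (subst (_≤ r) a≡ a≤r))
  ... | inj₂ (yy r<z a≡ _)   = ⊥-elim (<⇒≱ (≤-trans r<z (≤-trans (n≤1+n z) (≤-reflexive (sym a≡)))) a≤r)

  y-neighbour : ∀ a z → suc r ≤ a → suc a ≤ r + s → adj a z ≡ true → z ≡ suc a ⊎ (suc z ≡ a × suc r ≤ z)
  y-neighbour a z r<a a<yₛ e with adj⇒Edge a z e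
  ... | inj₁ (uw refl _ _)   = case r<a of λ ()
  ... | inj₁ (wyₛ _ a≤r _)   = ⊥-elim (<⇒≱ r<a a≤r)
  ... | inj₁ (yy _ z≡ _)     = inj₁ z≡
  ... | inj₂ (uw _ _ a≤r)    = ⊥-elim (<⇒≱ r<a a≤r)
  ... | inj₂ (wyₛ _ _ a≡)    = ⊥-elim (<-irrefl a≡ a<yₛ)
  ... | inj₂ (yy r<z a≡ _)   = inj₂ (sym a≡ , r<z)

  yₛ-neighbour : ∀ z → adj (r + s) z ≡ true → (1 ≤ z × z ≤ r) ⊎ (suc z ≡ r + s × suc r ≤ z)
  yₛ-neighbour z e with adj⇒Edge (r + s) z e
  ... | inj₁ (uw yₛ≡0 _ _)   = ⊥-elim (yₛ≢0 yₛ≡0)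
  ... | inj₁ (wyₛ _ yₛ≤r _)  = ⊥-elim (<⇒≱ y₁≤yₛ yₛ≤r)
  ... | inj₁ (yy _ z≡ z≤)    = ⊥-elim (1+n≰n (subst (_≤ r + s) z≡ z≤))
  ... | inj₂ (uw _ _ yₛ≤r)   = ⊥-elim (<⇒≱ y₁≤yₛ yₛ≤r)
  ... | inj₂ (wyₛ 1≤z z≤r _) = inj₁ (1≤z , z≤r)
  ... | inj₂ (yy r<z yₛ≡ _)  = inj₂ (sym yₛ≡ , r<z)

  y-neighbour-onP : ∀ v z → suc r ≤ v → suc v ≤ r + s → adj v z ≡ true → suc r ≤ z × z ≤ r + s
  y-neighbour-onP v z r<v v<yₛ e with y-neighbour v z r<v v<yₛ e
  ... | inj₁ refl         = ≤-trans r<v (n≤1+n v) , v<yₛ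
  ... | inj₂ (z+1≡v , r<z) = r<z , ≤-trans (n≤1+n z) (≤-trans (≤-reflexive z+1≡v) (<⇒≤ v<yₛ))

  byRegion : Bool → (ℕ → Bool) → (ℕ → Bool) → ℕ → Bool
  byRegion bu C X zero    = bu
  byRegion bu C X (suc k) = if suc k ≤ᵇ r then C (suc k) else X (suc k)

  byRegion-W : ∀ bu C X i → 1 ≤ i → i ≤ r → byRegion bu C X i ≡ C i
  byRegion-W bu C X (suc k) _ i≤r rewrite ≤⇒≤ᵇ≡true i≤r = refl

  byRegion-P : ∀ bu C X a → suc r ≤ a → byRegion bu C X a ≡ X a
  byRegion-P bu C X (suc k) r<a rewrite ≰⇒≤ᵇ≡false (suc k) r (<⇒≱ r<a) = refl

  count-regions : ∀ f → count f 0 n ≡ bool→ℕ (f 0) + (count f 1 r + count f (suc r) s)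
  count-regions f = trans (cong (count f 0) (+-comm (r + s) 1)) (cong (bool→ℕ (f 0) +_) (count-+ f 1 r s))

  count-byRegion : ∀ bu C X → count (byRegion bu C X) 0 n ≡ bool→ℕ bu + (count C 1 r + count X (suc r) s)
  count-byRegion bu C X = trans (count-regions (byRegion bu C X)) (cong (bool→ℕ bu +_) (cong₂ _+_
    (count-cong _ _ 1 r λ k (1≤k , k<) → byRegion-W bu C X k 1≤k (≤-pred k<))
    (count-cong _ _ (suc r) s λ k (r<k , _) → byRegion-P bu C X k r<k)))

  ∣⟦byRegion⟧∣ : ∀ bu C X → ∣ ⟦_⟧ {n} (byRegion bu C X) ∣ ≡ bool→ℕ bu + (count C 1 r + count X (suc r) s)
  ∣⟦byRegion⟧∣ bu C X = trans (∣⟦⟧∣ {n} (byRegion bu C X)) (count-byRegion bu C X)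

  fort-pair : ∀ {i j} → 1 ≤ i → i ≤ r → 1 ≤ j → j ≤ r → i ≢ j → IsFort G ⟦ pair i j ⟧
  fort-pair {i} {j} 1≤i i≤r 1≤j j≤r i≢j = isFortᴺ-intro (pair i j) i (w<n i≤r) i∈ outside
    where
    i∈ = pairˡ i j
    j∈ = pairʳ i j
    notW : ∀ {z} → (z ≡ 0 ⊎ suc r ≤ z) → pair i j z ≡ false
    notW (inj₁ refl)    = pair-≢ i j 0 (λ 0≡i → <⇒≢ 1≤i 0≡i) (λ 0≡j → <⇒≢ 1≤j 0≡j)
    notW {z} (inj₂ r<z) = pair-≢ i j z (λ { refl → <⇒≱ r<z i≤r }) (λ { refl → <⇒≱ r<z j≤r })
    outside : ∀ v → v < n → pair i j v ≡ false → ZeroOrTwoNeighboursIn (pair i j) v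
    outside v v<n _ with region v v<n
    ... | atU refl = inj₂ (i , j , w<n i≤r , w<n j≤r , i≢j , (i∈ , Edge⇒adj (uw refl 1≤i i≤r)) , (j∈ , Edge⇒adj (uw refl 1≤j j≤r)))
    ... | inW 1≤v v≤r = inj₁ λ z _ vz → case w-neighbour v z 1≤v v≤r vz of λ where
            (inj₁ refl) → notW (inj₁ refl)
            (inj₂ refl) → notW (inj₂ y₁≤yₛ)
    ... | onP r<v v≤yₛ with v ≟ r + s
    ...   | yes refl = inj₂ (i , j , w<n i≤r , w<n j≤r , i≢j ,
                             (i∈ , Edge⇒adjᵒ (wyₛ 1≤i i≤r refl)) , (j∈ , Edge⇒adjᵒ (wyₛ 1≤j j≤r refl)))
    ...   | no v≢yₛ  = inj₁ λ z _ vz → notW (inj₂ (proj₁ (y-neighbour-onP v z r<v (≤∧≢⇒< v≤yₛ v≢yₛ) vz)))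

  InnerIndependent : (ℕ → Bool) → Set
  InnerIndependent X = X (suc r) ≡ false × X (r + s) ≡ false ×
                       (∀ a → suc r ≤ a → suc a ≤ r + s → X a ≡ true → X (suc a) ≡ false)

  fort-uPath : ∀ C X → InnerIndependent X → IsFort G ⟦ byRegion true C (not ∘ X) ⟧
  fort-uPath C X (Xy₁ , Xyₛ , independent) = isFortᴺ-intro φ 0 (<n z≤n) refl outside
    where
    φ = byRegion true C (not ∘ X)
    φ-P : ∀ a → suc r ≤ a → φ a ≡ not (X a)
    φ-P a r<a = byRegion-P true C (not ∘ X) a r<a
    onPath : ∀ v → suc r ≤ v → v ≤ r + s → X v ≡ true → ZeroOrTwoNeighboursIn φ v
    onPath (suc c) r<v v≤yₛ Xv with c ≟ r | suc c ≟ r + s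
    ... | yes refl | _        = ⊥-elim (not-¬ Xv Xy₁)
    ... | no _     | yes v≡yₛ = ⊥-elim (not-¬ Xv (subst (λ a → X a ≡ false) (sym v≡yₛ) Xyₛ))
    ... | no c≢r   | no v≢yₛ  =
      inj₂ (c , suc (suc c) , <n (<⇒≤ (<⇒≤ v<yₛ)) , <n v<yₛ , <⇒≢ (m<n⇒m<1+n (n<1+n c)) ,
            (trans (φ-P c r<c) (cong not Xc) , Edge⇒adjᵒ (yy r<c refl v≤yₛ)) ,
            (trans (φ-P (suc (suc c)) (m<n⇒m<1+n r<v)) (cong not (independent (suc c) r<v v<yₛ Xv)) ,
             Edge⇒adj (yy r<v refl v<yₛ)))
      where
      r<c : suc r ≤ c
      r<c = ≤∧≢⇒< (≤-pred r<v) (c≢r ∘ sym)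
      v<yₛ : suc (suc c) ≤ r + s
      v<yₛ = ≤∧≢⇒< v≤yₛ v≢yₛ
      Xc : X c ≡ false
      Xc = ¬-not λ Xc → not-¬ Xv (independent c r<c v≤yₛ Xc)
    outside : ∀ v → v < n → φ v ≡ false → ZeroOrTwoNeighboursIn φ v
    outside v v<n φv with region v v<n
    ... | atU refl = case φv of λ ()
    ... | inW 1≤v v≤r = inj₂ (0 , r + s , <n z≤n , <n ≤-refl , yₛ≢0 ∘ sym , (refl , Edge⇒adjᵒ (uw refl 1≤v v≤r)) ,
                              (trans (φ-P (r + s) y₁≤yₛ) (cong not Xyₛ) , Edge⇒adj (wyₛ 1≤v v≤r refl)))
    ... | onP r<v v≤yₛ = onPath v r<v v≤yₛ (not≡false⇒≡true (trans (sym (φ-P v r<v)) φv))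

  fort-u∪C∪P : ∀ C → IsFort G ⟦ byRegion true C (λ _ → true) ⟧
  fort-u∪C∪P C = fort-uPath C (λ _ → false) (refl , refl , λ _ _ _ ())

  w₁ w₂ : ℕ
  w₁ = 1
  w₂ = 2

  fort-u∪W : IsFort G ⟦ byRegion true (λ _ → true) (λ _ → false) ⟧
  fort-u∪W = isFortᴺ-intro φ 0 (<n z≤n) refl outside
    where
    φ = byRegion true (λ _ → true) (λ _ → false)
    φ-W = byRegion-W true (λ _ → true) (λ _ → false)
    outside : ∀ v → v < n → φ v ≡ false → ZeroOrTwoNeighboursIn φ v
    outside v v<n φv with region v v<n
    ... | atU refl    = case φv of λ ()
    ... | inW 1≤v v≤r = case trans (sym φv) (φ-W v 1≤v v≤r) of λ ()
    ... | onP r<v v≤yₛ with v ≟ r + s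
    ...   | yes refl = inj₂ (w₁ , w₂ , w<n r≥1 , w<n r≥2 , (λ ()) ,
                             (φ-W w₁ ≤-refl r≥1 , Edge⇒adjᵒ (wyₛ ≤-refl r≥1 refl)) ,
                             (φ-W w₂ (s≤s z≤n) r≥2 , Edge⇒adjᵒ (wyₛ (s≤s z≤n) r≥2 refl)))
    ...   | no v≢yₛ  = inj₁ λ z _ vz →
      byRegion-P true (λ _ → true) (λ _ → false) z (proj₁ (y-neighbour-onP v z r<v (≤∧≢⇒< v≤yₛ v≢yₛ) vz))

  fort-W∪P : IsFort G ⟦ byRegion false (λ _ → true) (λ _ → true) ⟧
  fort-W∪P = isFortᴺ-intro φ w₁ (w<n r≥1) (φ-W w₁ ≤-refl r≥1) outside
    where
    φ = byRegion false (λ _ → true) (λ _ → true)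
    φ-W = byRegion-W false (λ _ → true) (λ _ → true)
    outside : ∀ v → v < n → φ v ≡ false → ZeroOrTwoNeighboursIn φ v
    outside v v<n φv with region v v<n
    ... | atU refl    = inj₂ (w₁ , w₂ , w<n r≥1 , w<n r≥2 , (λ ()) ,
                              (φ-W w₁ ≤-refl r≥1 , Edge⇒adj (uw refl ≤-refl r≥1)) ,
                              (φ-W w₂ (s≤s z≤n) r≥2 , Edge⇒adj (uw refl (s≤s z≤n) r≥2)))
    ... | inW 1≤v v≤r = case trans (sym φv) (φ-W v 1≤v v≤r) of λ ()
    ... | onP r<v _   = case trans (sym φv) (byRegion-P false (λ _ → true) (λ _ → true) v r<v) of λ ()

  module FortStructure {F : Subset n} (isFort : IsFort G F) where

    private
      sole : ∀ {v a} → v < n → χ F v ≡ false → a < n → χ F a ≡ true → adj v a ≡ true →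
             (∀ z → z < n → z ≢ a → adj v z ≡ true → χ F z ≡ false) → Empty
      sole = fortᴺ-soleNeighbour isFort

    y₁∉⇒y₂∉ : χ F (suc r) ≡ false → χ F (suc (suc r)) ≡ false
    y₁∉⇒y₂∉ y₁∉ = ¬-not λ y₂∈ → sole (<n (<⇒≤ y₂≤yₛ)) y₁∉ (<n y₂≤yₛ) y₂∈ (Edge⇒adj (yy ≤-refl refl y₂≤yₛ))
      λ z _ z≢y₂ y₁z → case y-neighbour (suc r) z ≤-refl y₂≤yₛ y₁z of λ where
        (inj₁ z≡y₂)       → ⊥-elim (z≢y₂ z≡y₂)
        (inj₂ (z+1≡ , r<z)) → ⊥-elim (<-irrefl (sym (suc-injective z+1≡)) r<z)

    neighbours-agree : ∀ c → suc r ≤ c → suc (suc c) ≤ r + s → χ F (suc c) ≡ false → χ F c ≡ χ F (suc (suc c))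
    neighbours-agree c r<c c+2≤yₛ c+1∉ with χ F c in Fc | χ F (suc (suc c)) in Fc+2
    ... | true  | true  = refl
    ... | false | false = refl
    ... | true  | false = ⊥-elim (sole (<n (<⇒≤ c+2≤yₛ)) c+1∉ (<n (<⇒≤ (<⇒≤ c+2≤yₛ))) Fc
        (Edge⇒adjᵒ (yy r<c refl (<⇒≤ c+2≤yₛ)))
        λ z _ z≢c e → case y-neighbour (suc c) z (m<n⇒m<1+n r<c) c+2≤yₛ e of λ where
          (inj₁ refl)       → Fc+2
          (inj₂ (z+1≡ , _)) → ⊥-elim (z≢c (suc-injective z+1≡)))
    ... | false | true  = ⊥-elim (sole (<n (<⇒≤ c+2≤yₛ)) c+1∉ (<n c+2≤yₛ) Fc+2
        (Edge⇒adj (yy (m<n⇒m<1+n r<c) refl c+2≤yₛ))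
        λ z _ z≢c+2 e → case y-neighbour (suc c) z (m<n⇒m<1+n r<c) c+2≤yₛ e of λ where
          (inj₁ z≡)         → ⊥-elim (z≢c+2 z≡)
          (inj₂ (z+1≡ , _)) → subst (λ a → χ F a ≡ false) (sym (suc-injective z+1≡)) Fc)

    w∉⇒u≡yₛ : ∀ i → 1 ≤ i → i ≤ r → χ F i ≡ false → χ F 0 ≡ χ F (r + s)
    w∉⇒u≡yₛ i 1≤i i≤r i∉ with χ F 0 in F0 | χ F (r + s) in Fyₛ
    ... | true  | true  = refl
    ... | false | false = refl
    ... | true  | false = ⊥-elim (sole (w<n i≤r) i∉ (<n z≤n) F0 (Edge⇒adjᵒ (uw refl 1≤i i≤r))
        λ z _ z≢0 e → case w-neighbour i z 1≤i i≤r e of λ where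
          (inj₁ z≡0)  → ⊥-elim (z≢0 z≡0)
          (inj₂ refl) → Fyₛ)
    ... | false | true  = ⊥-elim (sole (w<n i≤r) i∉ (<n ≤-refl) Fyₛ (Edge⇒adj (wyₛ 1≤i i≤r refl))
        λ z _ z≢yₛ e → case w-neighbour i z 1≤i i≤r e of λ where
          (inj₁ refl) → F0
          (inj₂ z≡yₛ) → ⊥-elim (z≢yₛ z≡yₛ))

    W∉⇒yₛ₋₁∉ : (∀ i → 1 ≤ i → i ≤ r → χ F i ≡ false) → χ F (r + s) ≡ false →
               ∀ c → suc c ≡ r + s → suc r ≤ c → χ F c ≡ false
    W∉⇒yₛ₋₁∉ W∉ yₛ∉ c c+1≡yₛ r<c = ¬-not λ c∈ → sole (<n ≤-refl) yₛ∉ (<n (≤-trans (n≤1+n c) (≤-reflexive c+1≡yₛ))) c∈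
        (Edge⇒adjᵒ (yy r<c (sym c+1≡yₛ) ≤-refl))
        λ z _ z≢c e → case yₛ-neighbour z e of λ where
          (inj₁ (1≤z , z≤r))  → W∉ z 1≤z z≤r
          (inj₂ (z+1≡ , _))   → ⊥-elim (z≢c (suc-injective (trans z+1≡ (sym c+1≡yₛ))))

    y₁∉⇒P∉ : χ F (suc r) ≡ false → ∀ a → suc r ≤ a → a ≤ r + s → χ F a ≡ false
    y₁∉⇒P∉ y₁∉ a r<a a≤yₛ = subst (λ b → χ F b ≡ false) (m∸n+n≡m r<a)
      (proj₁ (bothOut (a ∸ suc r) (subst (_≤ r + s) (sym (m∸n+n≡m r<a)) a≤yₛ)))
      where
      bothOut : ∀ k → k + suc r ≤ r + s → χ F (k + suc r) ≡ false × (suc (k + suc r) ≤ r + s → χ F (suc (k + suc r)) ≡ false)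
      bothOut zero    _  = y₁∉ , λ _ → y₁∉⇒y₂∉ y₁∉
      bothOut (suc k) k≤ with bothOut k (<⇒≤ k≤)
      ... | k∉ , k+1∉ = k+1∉ k≤ , λ k+2≤ → trans (sym (neighbours-agree (k + suc r) (m≤n+m _ k) k+2≤ (k+1∉ k≤))) k∉

    P∈⇒y₁∈ : ∀ a → suc r ≤ a → a ≤ r + s → χ F a ≡ true → χ F (suc r) ≡ true
    P∈⇒y₁∈ a r<a a≤yₛ a∈ = ¬-not λ y₁∉ → not-¬ a∈ (y₁∉⇒P∉ y₁∉ a r<a a≤yₛ)

    y₁∈⇒meetsAdjacentPairs : χ F (suc r) ≡ true → ∀ k → suc (k + suc r) ≤ r + s →
                             χ F (k + suc r) ≡ true ⊎ χ F (suc (k + suc r)) ≡ true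
    y₁∈⇒meetsAdjacentPairs y₁∈ zero    _  = inj₁ y₁∈
    y₁∈⇒meetsAdjacentPairs y₁∈ (suc k) k< with y₁∈⇒meetsAdjacentPairs y₁∈ k (<⇒≤ k<)
    ... | inj₂ k+1∈ = inj₁ k+1∈
    ... | inj₁ k∈ with χ F (suc (k + suc r)) in k+1
    ...   | true  = inj₁ refl
    ...   | false = inj₂ (trans (sym (neighbours-agree (k + suc r) (m≤n+m _ k) k< k+1)) k∈)

    y₁∈⇒noGap : χ F (suc r) ≡ true → ∀ a → suc r ≤ a → suc a ≤ r + s → χ F a ≡ false → χ F (suc a) ≡ false → Empty
    y₁∈⇒noGap y₁∈ a r<a a<yₛ a∉ a+1∉
      with y₁∈⇒meetsAdjacentPairs y₁∈ (a ∸ suc r) (subst (λ b → suc b ≤ r + s) (sym (m∸n+n≡m r<a)) a<yₛ)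
    ... | inj₁ a∈   = not-¬ (subst (λ b → χ F b ≡ true) (m∸n+n≡m r<a) a∈) a∉
    ... | inj₂ a+1∈ = not-¬ (subst (λ b → χ F (suc b) ≡ true) (m∸n+n≡m r<a) a+1∈) a+1∉

  between : ℕ → ℕ → ℕ → Bool
  between a b z = (a ≤ᵇ z) ∧ (z ≤ᵇ b)

  between⁻ : ∀ a b z → between a b z ≡ true → a ≤ z × z ≤ b
  between⁻ a b z e = let (a≤z , z≤b) = ∧-true⁻ (a ≤ᵇ z) e in ≤ᵇ≡true⇒≤ a z a≤z , ≤ᵇ≡true⇒≤ z b z≤b

  between⁺ : ∀ {a b z} → a ≤ z → z ≤ b → between a b z ≡ true
  between⁺ a≤z z≤b = ∧-true⁺ (≤⇒≤ᵇ≡true a≤z) (≤⇒≤ᵇ≡true z≤b)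

  private
    reaches-extend : ∀ (φ : ℕ → Bool) w (ψ : ℕ → Bool) → Reaches (λ z → φ z ∨ ψ z) → Reaches (λ z → (φ z ∨ (z ≡ᵇ w)) ∨ ψ z)
    reaches-extend φ w ψ R = reaches-mono (λ z → φ z ∨ ψ z) (λ z → (φ z ∨ (z ≡ᵇ w)) ∨ ψ z) R λ v _ e → case ∨-true⁻ (φ v) e of λ where
      (inj₁ φv) → ∨-trueˡ (ψ v) (∨-trueˡ (v ≡ᵇ w) φv)
      (inj₂ ψv) → ∨-trueʳ (φ v ∨ (v ≡ᵇ w)) ψv

    reaches-absorb : ∀ (φ ψ : ℕ → Bool) → (∀ v → ψ v ≡ true → φ v ≡ true) → Reaches (λ z → φ z ∨ ψ z) → Reaches φ
    reaches-absorb φ ψ ψ⇒φ R = reaches-mono (λ z → φ z ∨ ψ z) φ R λ v _ e → case ∨-true⁻ (φ v) e of λ where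
      (inj₁ φv) → φv
      (inj₂ ψv) → ψ⇒φ v ψv

    forward : ∀ k (φ : ℕ → Bool) a b → k + b ≡ r + s → suc r ≤ a → a ≤ b → (a < b ⊎ a ≡ suc r) →
              (∀ c → a ≤ c → c ≤ b → φ c ≡ true) → Reaches (λ z → φ z ∨ between a (r + s) z) → Reaches φ
    forward zero    φ a b refl _ _ _ blue R =
      reaches-absorb φ (between a (r + s)) (λ v e → let (a≤v , v≤yₛ) = between⁻ a (r + s) v e in blue v a≤v v≤yₛ) R
    forward (suc k) φ a b k+1+b≡yₛ r<a a≤b a<b⊎a≡y₁ blue R =
      reaches-force φ b (suc b) (<n (<⇒≤ b<yₛ)) (<n b<yₛ) (blue b a≤b ≤-refl) (Edge⇒adj (yy r<b refl b<yₛ))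
        (λ v _ bv v≢b+1 → case y-neighbour b v r<b b<yₛ bv of λ where
          (inj₁ v≡b+1)        → ⊥-elim (v≢b+1 v≡b+1)
          (inj₂ (v+1≡b , r<v)) → blue v (a≤pred v v+1≡b r<v) (≤-trans (n≤1+n v) (≤-reflexive v+1≡b)))
        (forward k (λ z → φ z ∨ (z ≡ᵇ suc b)) a (suc b) (trans (+-suc k b) k+1+b≡yₛ) r<a (m≤n⇒m≤1+n a≤b) (inj₁ (s≤s a≤b))
          (λ c a≤c c≤b+1 → case m≤n⇒m<n∨m≡n c≤b+1 of λ where
            (inj₁ c≤b)  → ∨-trueˡ _ (blue c a≤c (≤-pred c≤b))
            (inj₂ refl) → ∨-trueʳ (φ (suc b)) (≡ᵇ-refl (suc b)))
          (reaches-extend φ (suc b) (between a (r + s)) R))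
      where
      b<yₛ : suc b ≤ r + s
      b<yₛ = subst (suc b ≤_) k+1+b≡yₛ (s≤s (m≤n+m b k))
      r<b : suc r ≤ b
      r<b = ≤-trans r<a a≤b
      a≤pred : ∀ v → suc v ≡ b → suc r ≤ v → a ≤ v
      a≤pred v v+1≡b r<v = case a<b⊎a≡y₁ of λ where
        (inj₁ a<b)  → ≤-pred (≤-trans a<b (≤-reflexive (sym v+1≡b)))
        (inj₂ refl) → r<v

    backward : ∀ k (φ : ℕ → Bool) a → k + suc r ≡ a → a ≤ r + s → (a < r + s ⊎ (∀ i → 1 ≤ i → i ≤ r → φ i ≡ true)) →
               (∀ c → a ≤ c → c ≤ r + s → φ c ≡ true) → Reaches (λ z → φ z ∨ between (suc r) (r + s) z) → Reaches φ
    backward zero    φ a refl _ _ blue R =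
      reaches-absorb φ (between (suc r) (r + s)) (λ v e → let (r<v , v≤yₛ) = between⁻ (suc r) (r + s) v e in blue v r<v v≤yₛ) R
    backward (suc k) φ a refl a≤yₛ a<yₛ⊎W blue R =
      reaches-force φ a c (<n a≤yₛ) (<n (<⇒≤ a≤yₛ)) (blue a ≤-refl a≤yₛ) (Edge⇒adjᵒ (yy r<c refl a≤yₛ)) others
        (backward k (λ z → φ z ∨ (z ≡ᵇ c)) c refl (<⇒≤ a≤yₛ) (inj₁ a≤yₛ)
          (λ c′ c≤c′ c′≤yₛ → case m≤n⇒m<n∨m≡n c≤c′ of λ where
            (inj₁ c<c′) → ∨-trueˡ _ (blue c′ c<c′ c′≤yₛ)
            (inj₂ refl) → ∨-trueʳ (φ c) (≡ᵇ-refl c))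
          (reaches-extend φ c (between (suc r) (r + s)) R))
      where
      c = k + suc r
      r<c : suc r ≤ c
      r<c = m≤n+m (suc r) k
      others : ∀ v → v < n → adj (suc c) v ≡ true → v ≢ c → φ v ≡ true
      others v _ av v≢c with suc c ≟ r + s
      ... | no a≢yₛ = case y-neighbour (suc c) v (m<n⇒m<1+n r<c) (≤∧≢⇒< a≤yₛ a≢yₛ) av of λ where
            (inj₁ refl)       → blue (suc (suc c)) (n≤1+n _) (≤∧≢⇒< a≤yₛ a≢yₛ)
            (inj₂ (v+1≡ , _)) → ⊥-elim (v≢c (suc-injective v+1≡))
      ... | yes a≡yₛ = case a<yₛ⊎W of λ where
            (inj₁ a<yₛ) → ⊥-elim (<-irrefl a≡yₛ a<yₛ)
            (inj₂ W∈)   → case yₛ-neighbour v (subst (λ x → adj x v ≡ true) a≡yₛ av) of λ where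
              (inj₁ (1≤v , v≤r)) → W∈ v 1≤v v≤r
              (inj₂ (v+1≡ , _))  → ⊥-elim (v≢c (suc-injective (trans v+1≡ (sym a≡yₛ))))

  -- The blue segment a … b forces forward up to yₛ; the backward neighbour of b is blue unless a = b = y₁.
  forceForward : ∀ (φ : ℕ → Bool) a b → b ≤ r + s → suc r ≤ a → a ≤ b → (a < b ⊎ a ≡ suc r) →
                 (∀ c → a ≤ c → c ≤ b → φ c ≡ true) → Reaches (λ z → φ z ∨ between a (r + s) z) → Reaches φ
  forceForward φ a b b≤yₛ = forward (r + s ∸ b) φ a b (m∸n+n≡m b≤yₛ)

  -- The blue segment a … yₛ forces backward down to y₁; if a = yₛ its other neighbours, all of W, must be blue.
  forceBackward : ∀ (φ : ℕ → Bool) a → suc r ≤ a → a ≤ r + s → (a < r + s ⊎ (∀ i → 1 ≤ i → i ≤ r → φ i ≡ true)) →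
                  (∀ c → a ≤ c → c ≤ r + s → φ c ≡ true) → Reaches (λ z → φ z ∨ between (suc r) (r + s) z) → Reaches φ
  forceBackward φ a r<a = backward (a ∸ suc r) φ a (m∸n+n≡m r<a)

  anotherW : ∀ i → ∃ λ j → 1 ≤ j × j ≤ r × j ≢ i
  anotherW i with i ≟ 1
  ... | yes refl = 2 , s≤s z≤n , r≥2 , (λ ())
  ... | no i≢1   = 1 , ≤-refl , r≥1 , i≢1 ∘ sym

  -- Some other wⱼ forces u, which then forces wᵢ.
  reaches-W∖w∪P : ∀ (φ : ℕ → Bool) i → 1 ≤ i → i ≤ r → (∀ j → 1 ≤ j → j ≤ r → j ≢ i → φ j ≡ true) →
                  (∀ c → suc r ≤ c → c ≤ r + s → φ c ≡ true) → Reaches φ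
  reaches-W∖w∪P φ i 1≤i i≤r W∖i P with anotherW i
  ... | j , 1≤j , j≤r , j≢i =
    reaches-force φ j 0 (w<n j≤r) (<n z≤n) (W∖i j 1≤j j≤r j≢i) (Edge⇒adjᵒ (uw refl 1≤j j≤r))
      (λ v _ jv v≢0 → case w-neighbour j v 1≤j j≤r jv of λ where
        (inj₁ v≡0)  → ⊥-elim (v≢0 v≡0)
        (inj₂ refl) → P (r + s) y₁≤yₛ ≤-refl)
      (reaches-force φ₀ 0 i (<n z≤n) (w<n i≤r) (∨-trueʳ (φ 0) refl) (Edge⇒adj (uw refl 1≤i i≤r))
        (λ v _ uv v≢i → let (1≤v , v≤r) = u-neighbour v uv in ∨-trueˡ (v ≡ᵇ 0) (W∖i v 1≤v v≤r v≢i))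
        (reaches-done (λ z → φ₀ z ∨ (z ≡ᵇ i)) λ v v<n → case region v v<n of λ where
          (atU refl)      → ∨-trueˡ (0 ≡ᵇ i) (∨-trueʳ (φ 0) refl)
          (inW 1≤v v≤r)   → case v ≟ i of λ where
            (yes refl) → ∨-trueʳ (φ₀ v) (≡ᵇ-refl v)
            (no v≢i)   → ∨-trueˡ (v ≡ᵇ i) (∨-trueˡ (v ≡ᵇ 0) (W∖i v 1≤v v≤r v≢i))
          (onP r<v v≤yₛ) → ∨-trueˡ (v ≡ᵇ i) (∨-trueˡ (v ≡ᵇ 0) (P v r<v v≤yₛ))))
    where
    φ₀ = λ z → φ z ∨ (z ≡ᵇ 0)

module SmallestMaximalZIr (r s : ℕ) (r≥2 : 2 ≤ r) (s≥3 : 3 ≤ s) where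
  open Structure r s r≥2 s≥3

  u-pair-isZIr : ∀ x → x < n → x ≢ 0 → IsZIr G ⟦ pair 0 x ⟧
  u-pair-isZIr x x<n x≢0 = isZIr-intro ⟦ pair 0 x ⟧ λ y y<n y∈ →
    case pair⁻ 0 x y (trans (sym (χ-⟦⟧ (pair 0 x) y y<n)) y∈) of λ where
      (inj₁ refl) → privateOf-u (region x x<n)
      (inj₂ refl) → privateOf-x (region x x<n)
    where
    private-u : ∀ φ → φ 0 ≡ true → φ x ≡ false → Private ⟦ pair 0 x ⟧ 0 φ
    private-u φ φ0 φx = private-in-pair 0 x 0 φ φ0 λ where
      k k≢0 (inj₁ k≡0) → ⊥-elim (k≢0 k≡0)
      k _   (inj₂ refl) → φx
    private-x : ∀ φ → φ x ≡ true → φ 0 ≡ false → Private ⟦ pair 0 x ⟧ x φ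
    private-x φ φx φ0 = private-in-pair 0 x x φ φx λ where
      k _   (inj₁ refl) → φ0
      k k≢x (inj₂ k≡x)  → ⊥-elim (k≢x k≡x)
    privateOf-u : Region x → ∃ λ φ → IsFort G ⟦ φ ⟧ × Private ⟦ pair 0 x ⟧ 0 φ
    privateOf-u (atU x≡0)     = ⊥-elim (x≢0 x≡0)
    privateOf-u (inW 1≤x x≤r) = byRegion true (λ _ → false) (λ _ → true) , fort-u∪C∪P (λ _ → false) ,
                                private-u _ refl (byRegion-W true (λ _ → false) (λ _ → true) x 1≤x x≤r)
    privateOf-u (onP r<x _)   = byRegion true (λ _ → true) (λ _ → false) , fort-u∪W ,
                                private-u _ refl (byRegion-P true (λ _ → true) (λ _ → false) x r<x)
    privateOf-x : Region x → ∃ λ φ → IsFort G ⟦ φ ⟧ × Private ⟦ pair 0 x ⟧ x φ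
    privateOf-x (atU x≡0)     = ⊥-elim (x≢0 x≡0)
    privateOf-x (inW 1≤x x≤r) with anotherW x
    ... | x′ , 1≤x′ , x′≤r , x′≢x = pair x x′ , fort-pair 1≤x x≤r 1≤x′ x′≤r (x′≢x ∘ sym) ,
          private-x _ (pairˡ x x′) (pair-≢ x x′ 0 (λ 0≡x → x≢0 (sym 0≡x)) (λ 0≡x′ → <⇒≢ 1≤x′ 0≡x′))
    privateOf-x (onP r<x _)   = byRegion false (λ _ → true) (λ _ → true) , fort-W∪P ,
                                private-x _ (byRegion-P false (λ _ → true) (λ _ → true) x r<x) refl

  uy₁ : ℕ → Bool
  uy₁ = pair 0 (suc r)

  uy₁-isZIr : IsZIr G ⟦ uy₁ ⟧
  uy₁-isZIr = u-pair-isZIr (suc r) (<n y₁≤yₛ) λ ()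

  uy₁-maximal : ∀ T → ⟦ uy₁ ⟧ ⊂ T → ¬ IsZIr G T
  uy₁-maximal T uy₁⊂T zirT = outsider (⊂⇒χ-witness uy₁⊂T)
    where
    T∋ : ∀ k → k < n → uy₁ k ≡ true → χ T k ≡ true
    T∋ k k<n e = ⊆⇒χ (proj₁ uy₁⊂T) k k<n (trans (χ-⟦⟧ uy₁ k k<n) e)
    Tu  = T∋ 0 (<n z≤n) (pairˡ 0 (suc r))
    Ty₁ = T∋ (suc r) (<n y₁≤yₛ) (pairʳ 0 (suc r))
    outsider : (∃ λ z → z < n × χ T z ≡ true × χ (⟦_⟧ {n} uy₁) z ≡ false) → Empty
    outsider (z , z<n , Tz , z∉) with region z z<n
    ... | atU refl = not-¬ (trans (χ-⟦⟧ uy₁ 0 z<n) (pairˡ 0 (suc r))) z∉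
    ... | inW 1≤z z≤r with privateFort zirT (<n z≤n) Tu
    ...   | F , isFort , Fu , F-avoids = not-¬ (P∈⇒y₁∈ (r + s) y₁≤yₛ ≤-refl (trans (sym (w∉⇒u≡yₛ z 1≤z z≤r Fz)) Fu))
                                               (F-avoids (suc r) (<n y₁≤yₛ) (λ ()) Ty₁)
      where
      open FortStructure isFort
      Fz = F-avoids z z<n (λ z≡0 → <⇒≢ 1≤z (sym z≡0)) Tz
    outsider (z , z<n , Tz , z∉) | onP r<z z≤yₛ with privateFort zirT z<n Tz
    ...   | F , isFort , Fz , F-avoids = not-¬ (P∈⇒y₁∈ z r<z z≤yₛ Fz) (F-avoids (suc r) (<n y₁≤yₛ) y₁≢z Ty₁)
      where
      open FortStructure isFort
      y₁≢z : suc r ≢ z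
      y₁≢z refl = not-¬ (trans (χ-⟦⟧ uy₁ (suc r) z<n) (pairʳ 0 (suc r))) z∉

  uy₁-card : ∣ ⟦_⟧ {n} uy₁ ∣ ≡ 2
  uy₁-card = trans (∣⟦⟧∣ {n} uy₁) (count-pair 0 (suc r) 0 n (z≤n , <n z≤n) (z≤n , <n y₁≤yₛ) (λ ()))

  maximalZIr-card≥2 : ∀ S → IsMaximalZIr G S → 2 ≤ ∣ S ∣
  maximalZIr-card≥2 S maxS with search (χ S) 0 n
  ... | inj₂ empty = ⊥-elim (maximalZIr-⊄ maxS uy₁ uy₁-isZIr (λ k k<n Sk → ⊥-elim (not-¬ Sk (empty k (z≤n , k<n))))
                                          0 (<n z≤n) (pairˡ 0 (suc r)) (empty 0 (z≤n , <n z≤n)))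
  ... | inj₁ (x , (_ , x<n) , Sx) with search (λ k → χ S k ∧ not (k ≡ᵇ x)) 0 n
  ...   | inj₁ (y , (_ , y<n) , e) = subst (2 ≤_) (sym (∣p∣≡count-χ S))
            (2≤count (χ S) 0 n x y (z≤n , x<n) (z≤n , y<n) (λ x≡y → not-¬ (≡⇒≡ᵇ≡true y x (sym x≡y)) (not≡true⇒≡false y≢x)) Sx Sy)
    where
    Sy  = proj₁ (∧-true⁻ (χ S y) e)
    y≢x = proj₂ (∧-true⁻ (χ S y) e)
  ...   | inj₂ onlyX = singleton (x ≟ 0)
    where
    only : ∀ k → k < n → χ S k ≡ true → k ≡ x
    only k k<n Sk = ≡ᵇ≡true⇒≡ k x (not≡false⇒≡true (trans (sym (cong (_∧ not (k ≡ᵇ x)) Sk)) (onlyX k (z≤n , k<n))))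
    S∌ : ∀ k → k < n → k ≢ x → χ S k ≡ false
    S∌ k k<n k≢x = ¬-not (k≢x ∘ only k k<n)
    singleton : Dec (x ≡ 0) → 2 ≤ ∣ S ∣
    singleton (yes refl) = ⊥-elim (maximalZIr-⊄ maxS uy₁ uy₁-isZIr
      (λ k k<n Sk → subst (λ a → uy₁ a ≡ true) (sym (only k k<n Sk)) (pairˡ 0 (suc r)))
      (suc r) (<n y₁≤yₛ) (pairʳ 0 (suc r)) (S∌ (suc r) (<n y₁≤yₛ) λ ()))
    singleton (no x≢0)   = ⊥-elim (maximalZIr-⊄ maxS (pair 0 x) (u-pair-isZIr x x<n x≢0)
      (λ k k<n Sk → subst (λ a → pair 0 x a ≡ true) (sym (only k k<n Sk)) (pairʳ 0 x))
      0 (<n z≤n) (pairˡ 0 x) (S∌ 0 (<n z≤n) (x≢0 ∘ sym)))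

  zir≡2 : zirNumber G 2
  zir≡2 = (⟦ uy₁ ⟧ , (uy₁-isZIr , uy₁-maximal) , uy₁-card) , maximalZIr-card≥2

module ZeroForcing (r s : ℕ) (r≥2 : 2 ≤ r) (s≥3 : 3 ≤ s) where
  open Structure r s r≥2 s≥3

  W∖ : ℕ → ℕ → Bool
  W∖ i z = not (z ≡ᵇ i)

  W∖-≢ : ∀ {i j} → j ≢ i → W∖ i j ≡ true
  W∖-≢ {i} {j} j≢i = cong not (≢⇒≡ᵇ≡false j i j≢i)

  count-W∖ : ∀ {i} → 1 ≤ i → i ≤ r → count (W∖ i) 1 r + 1 ≡ r
  count-W∖ {i} 1≤i i≤r = trans (+-comm _ 1) (count-allBut 1 r i (1≤i , s≤s i≤r))

  W∖w∪y₁ : ℕ → ℕ → Bool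
  W∖w∪y₁ i = byRegion false (W∖ i) (_≡ᵇ suc r)

  W∖w∪y₁-reaches : ∀ {i} → 1 ≤ i → i ≤ r → Reaches (W∖w∪y₁ i)
  W∖w∪y₁-reaches {i} 1≤i i≤r =
    forceForward (W∖w∪y₁ i) (suc r) (suc r) y₁≤yₛ ≤-refl ≤-refl (inj₂ refl)
      (λ c r<c c≤r+1 → subst (λ a → W∖w∪y₁ i a ≡ true) (≤-antisym r<c c≤r+1)
                         (trans (byRegion-P false (W∖ i) (_≡ᵇ suc r) (suc r) ≤-refl) (≡ᵇ-refl (suc r))))
      (reaches-W∖w∪P _ i 1≤i i≤r
        (λ j 1≤j j≤r j≢i → ∨-trueˡ _ (trans (byRegion-W false (W∖ i) (_≡ᵇ suc r) j 1≤j j≤r) (W∖-≢ j≢i)))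
        (λ c r<c c≤yₛ → ∨-trueʳ (W∖w∪y₁ i c) (between⁺ r<c c≤yₛ)))

  W∖w∪y₁-card : ∀ {i} → 1 ≤ i → i ≤ r → ∣ ⟦_⟧ {n} (W∖w∪y₁ i) ∣ ≡ r
  W∖w∪y₁-card {i} 1≤i i≤r = trans (∣⟦byRegion⟧∣ false (W∖ i) (_≡ᵇ suc r))
    (trans (cong (count (W∖ i) 1 r +_) (count-≡ᵇ (suc r) (suc r) s (≤-refl , s≤s y₁≤yₛ))) (count-W∖ 1≤i i≤r))

  zfs-W-but-one : ∀ B → ZFReaches G B → ∃ λ i → 1 ≤ i × i ≤ r × (∀ j → 1 ≤ j → j ≤ r → j ≢ i → χ B j ≡ true)
  zfs-W-but-one B R with search (not ∘ χ B) 1 r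
  ... | inj₂ noneMissing = 1 , ≤-refl , r≥1 , λ j 1≤j j≤r _ → not≡false⇒≡true (noneMissing j (1≤j , s≤s j≤r))
  ... | inj₁ (i , (1≤i , i<) , Bi) with search (λ k → not (χ B k) ∧ W∖ i k) 1 r
  ...   | inj₂ onlyI = i , 1≤i , ≤-pred i< , λ j 1≤j j≤r j≢i →
            not≡false⇒≡true (trans (sym (∧-identityʳ _)) (trans (cong (not (χ B j) ∧_) (sym (W∖-≢ j≢i))) (onlyI j (1≤j , s≤s j≤r))))
  ...   | inj₁ (j , (1≤j , j<) , e) = ⊥-elim (¬reaches-outside-fort B (pair i j) (fort-pair 1≤i (≤-pred i<) 1≤j (≤-pred j<) i≢j)
            (λ k k<n Bk → ¬-not λ ijk → case pair⁻ i j k ijk of λ where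
              (inj₁ refl) → not-¬ Bk (not≡true⇒≡false Bi)
              (inj₂ refl) → not-¬ Bk (not≡true⇒≡false Bj)) R)
    where
    Bj  = proj₁ (∧-true⁻ (not (χ B j)) e)
    i≢j : i ≢ j
    i≢j i≡j = not-¬ (≡⇒≡ᵇ≡true j i (sym i≡j)) (not≡true⇒≡false (proj₂ (∧-true⁻ (not (χ B j)) e)))

  zfs-card≥r : ∀ B → ZFReaches G B → r ≤ ∣ B ∣
  zfs-card≥r B R with zfs-W-but-one B R
  ... | i , 1≤i , i≤r , W∖i⊆B = subst (r ≤_) (sym (trans (∣p∣≡count-χ B) (count-regions (χ B)))) (bound (χ B i) refl)
    where
    σ = χ B
    cW = count σ 1 r
    cP = count σ (suc r) s
    bound : ∀ b → σ i ≡ b → r ≤ bool→ℕ (σ 0) + (cW + cP)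
    bound true Bi = ≤-trans (≤-reflexive (sym (count-all σ 1 r λ j (1≤j , j<) → case j ≟ i of λ where
                                              (yes refl) → Bi
                                              (no j≢i)   → W∖i⊆B j 1≤j (≤-pred j<) j≢i)))
                            (≤-trans (m≤m+n cW cP) (m≤n+m _ (bool→ℕ (σ 0))))
    bound false Bi = begin
      r                        ≤⟨ subst (_≤ suc cW) (count-all (λ _ → true) 1 r λ _ _ → refl)
                                    (count-mono-except (λ _ → true) σ 1 r i λ j (1≤j , j<) j≢i _ → W∖i⊆B j 1≤j (≤-pred j<) j≢i) ⟩
      suc cW                   ≡⟨ +-comm 1 cW ⟩
      cW + 1                   ≤⟨ +-monoʳ-≤ cW uOrP ⟩
      cW + (bool→ℕ (σ 0) + cP) ≡⟨ x∙yz≈y∙xz cW (bool→ℕ (σ 0)) cP ⟩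
      bool→ℕ (σ 0) + (cW + cP) ∎
      where
      open ≤-Reasoning
      uOrP : 1 ≤ bool→ℕ (σ 0) + cP
      uOrP with reaches-meets-fort R (byRegion true (_≡ᵇ i) (λ _ → true)) (fort-u∪C∪P (_≡ᵇ i))
      ... | k , k<n , Bk , Fk with region k k<n
      ...   | atU refl      rewrite Bk = s≤s z≤n
      ...   | inW 1≤k k≤r   =
        ⊥-elim (not-¬ (subst (λ a → σ a ≡ true) (≡ᵇ≡true⇒≡ k i (trans (sym (byRegion-W true (_≡ᵇ i) _ k 1≤k k≤r)) Fk)) Bk) Bi)
      ...   | onP r<k k≤yₛ  = ≤-trans (1≤count σ (suc r) s k (r<k , s≤s k≤yₛ) Bk) (m≤n+m _ (bool→ℕ (σ 0)))

  Z≡r : ZeroForcingNumber G r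
  Z≡r = (⟦ W∖w∪y₁ 1 ⟧ , W∖w∪y₁-reaches ≤-refl r≥1 , W∖w∪y₁-card ≤-refl r≥1) , zfs-card≥r

module LargestZIr (r s : ℕ) (r≥2 : 2 ≤ r) (s≥3 : 3 ≤ s) (m : ℕ) (s≡2m+1 : s ≡ suc (m + m)) where
  open Structure r s r≥2 s≥3

  ⌊/2⌋≤m : ∀ {k} → k ≤ s → ⌊ k /2⌋ ≤ m
  ⌊/2⌋≤m {k} k≤s = subst (⌊ k /2⌋ ≤_) (sym (n≡⌈n+n/2⌉ m)) (⌊n/2⌋-mono (subst (k ≤_) s≡2m+1 k≤s))

  -- A set of path vertices avoiding y₁ without two consecutive members lives on y₂ … yₛ, 2m vertices.
  pathCount≤m : ∀ f → f (suc r) ≡ false → (∀ a → suc r ≤ a → suc a ≤ r + s → f a ≡ true → f (suc a) ≡ false) →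
                count f (suc r) s ≤ m
  pathCount≤m f fy₁ independent = begin
    count f (suc r) s                                   ≡⟨ cong (count f (suc r)) s≡2m+1 ⟩
    bool→ℕ (f (suc r)) + count f (suc (suc r)) (m + m)  ≡⟨ cong (λ b → bool→ℕ b + count f (suc (suc r)) (m + m)) fy₁ ⟩
    count f (suc (suc r)) (m + m)                       ≤⟨ count-noAdjacent f (suc (suc r)) (m + m) (λ k (r<k , _) (_ , k+1<) →
                                                             independent k (<⇒≤ r<k) (≤-pred (subst (suc k <_) end≡ k+1<))) ⟩
    ⌈ m + m /2⌉                                         ≡⟨ sym (n≡⌈n+n/2⌉ m) ⟩
    m                                                   ∎
    where
    open ≤-Reasoning
    end≡ : suc (suc r) + (m + m) ≡ suc (r + s)
    end≡ = cong suc (trans (sym (+-suc r (m + m))) (cong (r +_) (sym s≡2m+1)))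

  pathCount≤m-outside-fort : ∀ {F} → IsFort G F → χ F (suc r) ≡ true → ∀ f →
                             (∀ k → suc r ≤ k → k ≤ r + s → f k ≡ true → χ F k ≡ false) → count f (suc r) s ≤ m
  pathCount≤m-outside-fort {F} isFort y₁∈F f f⇒∉F = pathCount≤m f
    (¬-not λ fy₁ → not-¬ y₁∈F (f⇒∉F (suc r) ≤-refl y₁≤yₛ fy₁))
    λ a r<a a<yₛ fa → ¬-not λ fa+1 →
      y₁∈⇒noGap y₁∈F a r<a a<yₛ (f⇒∉F a r<a (<⇒≤ a<yₛ) fa) (f⇒∉F (suc a) (m<n⇒m<1+n r<a) a<yₛ fa+1)
    where open FortStructure isFort

  pathCount≤m+1 : ∀ S → IsZIr G S → count (χ S) (suc r) s ≤ suc m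
  pathCount≤m+1 S zirS with search (χ S) (suc r) s
  ... | inj₂ none = subst (_≤ suc m) (sym (count-none (χ S) (suc r) s none)) z≤n
  ... | inj₁ (x , (r<x , x<) , Sx) with privateFort zirS (<n (≤-pred x<)) Sx
  ...   | F , isFort , Fx , F-avoids =
    ≤-trans (count-mono-except (χ S) S∖x (suc r) s x λ k _ k≢x Sk → ∧-true⁺ Sk (cong not (≢⇒≡ᵇ≡false k x k≢x)))
            (s≤s (pathCount≤m-outside-fort isFort (P∈⇒y₁∈ x r<x (≤-pred x<) Fx) S∖x λ k _ k≤yₛ e →
              let (Sk , k≢x) = ∧-true⁻ (χ S k) e in
              F-avoids k (<n k≤yₛ) (λ k≡x → not-¬ (≡⇒≡ᵇ≡true k x k≡x) (not≡true⇒≡false k≢x)) Sk))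
    where
    open FortStructure isFort
    S∖x : ℕ → Bool
    S∖x k = χ S k ∧ not (k ≡ᵇ x)

  pathCount≤m-if-u-w : ∀ S → IsZIr G S → χ S 0 ≡ true → ∀ j → 1 ≤ j → j ≤ r → χ S j ≡ true → count (χ S) (suc r) s ≤ m
  pathCount≤m-if-u-w S zirS Su j 1≤j j≤r Sj with privateFort zirS (<n z≤n) Su
  ... | F , isFort , Fu , F-avoids = pathCount≤m-outside-fort isFort y₁∈F (χ S) λ k r<k k≤yₛ →
          F-avoids k (<n k≤yₛ) (λ { refl → case r<k of λ () })
    where
    open FortStructure isFort
    y₁∈F : χ F (suc r) ≡ true
    y₁∈F = P∈⇒y₁∈ (r + s) y₁≤yₛ ≤-refl
             (trans (sym (w∉⇒u≡yₛ j 1≤j j≤r (F-avoids j (w<n j≤r) (λ j≡0 → <⇒≢ 1≤j (sym j≡0)) Sj))) Fu)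

  record SpanningPrivateFort (T : Subset n) (x : ℕ) : Set where
    field
      fort      : Subset n
      isFort    : IsFort G fort
      isPrivate : Private T x (χ fort)
      ∋u        : χ fort 0 ≡ true
      ∋y₁       : χ fort (suc r) ≡ true
      ∋yₛ       : χ fort (r + s) ≡ true

  -- A private fort of x misses W ⊆ T, so it contains u iff it contains yₛ; and a fort meeting the path contains y₁.
  spanningPrivateFort : ∀ T → IsZIr G T → (∀ i → 1 ≤ i → i ≤ r → χ T i ≡ true) →
                        ∀ x → χ T x ≡ true → x ≡ 0 ⊎ (suc r ≤ x × x ≤ r + s) → SpanningPrivateFort T x
  spanningPrivateFort T zirT W⊆T x Tx x∉W = spanning (privateFort zirT x<n Tx)
    where
    x<n : x < n
    x<n = [ (λ x≡0 → subst (_< n) (sym x≡0) (<n z≤n)) , (λ (_ , x≤yₛ) → <n x≤yₛ) ]′ x∉W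
    spanning : (∃ λ F → IsFort G F × Private T x (χ F)) → SpanningPrivateFort T x
    spanning (F , isFort , Fx , F-avoids) = record
      { fort = F ; isFort = isFort ; isPrivate = Fx , F-avoids ; ∋u = Fu ; ∋y₁ = P∈⇒y₁∈ (r + s) y₁≤yₛ ≤-refl Fyₛ ; ∋yₛ = Fyₛ }
      where
      open FortStructure isFort
      W∉F : ∀ i → 1 ≤ i → i ≤ r → χ F i ≡ false
      W∉F i 1≤i i≤r = F-avoids i (w<n i≤r) i≢x (W⊆T i 1≤i i≤r)
        where
        i≢x : i ≢ x
        i≢x i≡x = case x∉W of λ where
          (inj₁ x≡0)       → <⇒≢ 1≤i (sym (trans i≡x x≡0))
          (inj₂ (r<x , _)) → <⇒≱ r<x (subst (_≤ r) i≡x i≤r)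
      u≡yₛ : χ F 0 ≡ χ F (r + s)
      u≡yₛ = w∉⇒u≡yₛ 1 ≤-refl r≥1 (W∉F 1 ≤-refl r≥1)
      yₛ∈F : x ≡ 0 ⊎ (suc r ≤ x × x ≤ r + s) → χ F (r + s) ≡ true
      yₛ∈F (inj₁ x≡0)          = trans (sym u≡yₛ) (subst (λ a → χ F a ≡ true) x≡0 Fx)
      yₛ∈F (inj₂ (r<x , x≤yₛ)) = ¬-not λ yₛ∉F →
        let c = pred (r + s)
            c+1≡yₛ : suc c ≡ r + s
            c+1≡yₛ = suc-pred (r + s) ⦃ >-nonZero (≤-trans z<s y₁≤yₛ) ⦄
            r<c : suc r ≤ c
            r<c = ≤-pred (subst (suc (suc r) ≤_) (sym c+1≡yₛ) y₂≤yₛ)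
        in y₁∈⇒noGap (P∈⇒y₁∈ x r<x x≤yₛ Fx) c r<c (≤-reflexive c+1≡yₛ) (W∉⇒yₛ₋₁∉ W∉F yₛ∉F c c+1≡yₛ r<c)
                     (subst (λ a → χ F a ≡ false) (sym c+1≡yₛ) yₛ∉F)
      Fyₛ : χ F (r + s) ≡ true
      Fyₛ = yₛ∈F x∉W
      Fu : χ F 0 ≡ true
      Fu = trans u≡yₛ Fyₛ

  module _ (S : Subset n) (zirS : IsZIr G S) (W⊆S : ∀ i → 1 ≤ i → i ≤ r → χ S i ≡ true) where
    open SpanningPrivateFort

    private
      spanning : ∀ k → suc r ≤ k → k ≤ r + s → χ S k ≡ true → SpanningPrivateFort S k
      spanning k r<k k≤yₛ Sk = spanningPrivateFort S zirS W⊆S k Sk (inj₂ (r<k , k≤yₛ))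

      avoids : ∀ {k} (Q : SpanningPrivateFort S k) → ∀ v → v < n → v ≢ k → χ S v ≡ true → χ (fort Q) v ≡ false
      avoids Q = proj₂ (isPrivate Q)

    pathCount≤1-if-in-all-forts : ∀ v → v < n → χ S v ≡ true →
                                  (∀ k r<k k≤yₛ Sk → χ (fort (spanning k r<k k≤yₛ Sk)) v ≡ true) → count (χ S) (suc r) s ≤ 1
    pathCount≤1-if-in-all-forts v v<n Sv ∋v = ≤-trans
      (count-mono (χ S) (_≡ᵇ v) (suc r) s λ k (r<k , k<) Sk → case k ≟ v of λ where
        (yes refl) → ≡ᵇ-refl k
        (no k≢v)   → ⊥-elim (not-¬ (∋v k r<k (≤-pred k<) Sk) (avoids (spanning k r<k (≤-pred k<) Sk) v v<n (k≢v ∘ sym) Sv)))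
      (count-≡ᵇ≤1 v (suc r) s)

    -- The private fort of any other path vertex of S would leave the gap a, a + 1.
    adjacent⇒pathPart⊆pair : ∀ a → suc r ≤ a → suc a ≤ r + s → χ S a ≡ true → χ S (suc a) ≡ true →
                             ∀ k → InRange (suc r) s k → χ S k ≡ true → pair a (suc a) k ≡ true
    adjacent⇒pathPart⊆pair a r<a a<yₛ Sa Sa+1 k (r<k , k<) Sk with k ≟ a | k ≟ suc a
    ... | yes refl | _        = pairˡ k (suc k)
    ... | no _     | yes refl = pairʳ a k
    ... | no k≢a   | no k≢a+1 = ⊥-elim (FortStructure.y₁∈⇒noGap (isFort Q) (∋y₁ Q) a r<a a<yₛ
                                  (avoids Q a (<n (<⇒≤ a<yₛ)) (k≢a ∘ sym) Sa) (avoids Q (suc a) (<n a<yₛ) (k≢a+1 ∘ sym) Sa+1))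
      where Q = spanning k r<k (≤-pred k<) Sk

    u+pathCount≤m-if-W⊆ : bool→ℕ (χ S 0) + count (χ S) (suc r) s ≤ m
    u+pathCount≤m-if-W⊆ = bound (χ S 0) refl
      where
      σ = χ S
      m≥1 : 1 ≤ m
      m≥1 = ⌊/2⌋≤m s≥3
      bound : ∀ b → σ 0 ≡ b → bool→ℕ b + count σ (suc r) s ≤ m
      bound true Su = subst (λ c → 1 + c ≤ m) (sym (count-none σ (suc r) s λ k (r<k , k<) → ¬-not λ Sk →
                        let Q = spanning k r<k (≤-pred k<) Sk in not-¬ (∋u Q) (avoids Q 0 (<n z≤n) (λ 0≡k → <⇒≢ (≤-trans z<s r<k) 0≡k) Su)))
                      m≥1
      bound false _ with σ (suc r) in Sy₁ | σ (r + s) in Syₛ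
      ... | true  | _     =
        ≤-trans (pathCount≤1-if-in-all-forts (suc r) (<n y₁≤yₛ) Sy₁ λ k r<k k≤yₛ Sk → ∋y₁ (spanning k r<k k≤yₛ Sk)) m≥1
      ... | false | true  =
        ≤-trans (pathCount≤1-if-in-all-forts (r + s) (<n ≤-refl) Syₛ λ k r<k k≤yₛ Sk → ∋yₛ (spanning k r<k k≤yₛ Sk)) m≥1
      ... | false | false with search (λ k → σ k ∧ σ (suc k)) (suc r) s
      ...   | inj₂ noAdjacent = pathCount≤m σ Sy₁ λ a r<a a<yₛ Sa →
              trans (sym (cong (_∧ σ (suc a)) Sa)) (noAdjacent a (r<a , s≤s (<⇒≤ a<yₛ)))
      ...   | inj₁ (a , (r<a , a<) , e) = begin
              count σ (suc r) s                ≤⟨ count-mono σ (pair a (suc a)) (suc r) s (adjacent⇒pathPart⊆pair a r<a a<yₛ Sa Sa+1) ⟩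
              count (pair a (suc a)) (suc r) s ≤⟨ count-pair≤2 a (suc a) (suc r) s ⟩
              2                                ≤⟨ ⌊/2⌋≤m (adjacentInner⇒s≥4 a y₁<a a+1<yₛ) ⟩
              m                                ∎
        where
        open ≤-Reasoning
        Sa   = proj₁ (∧-true⁻ (σ a) e)
        Sa+1 = proj₂ (∧-true⁻ (σ a) e)
        a<yₛ : suc a ≤ r + s
        a<yₛ = ≤∧≢⇒< (≤-pred a<) λ { refl → not-¬ Sa Syₛ }
        a+1<yₛ : suc (suc a) ≤ r + s
        a+1<yₛ = ≤∧≢⇒< a<yₛ λ a+1≡yₛ → not-¬ Sa+1 (subst (λ b → σ b ≡ false) (sym a+1≡yₛ) Syₛ)
        y₁<a : suc (suc r) ≤ a
        y₁<a = ≤∧≢⇒< r<a λ { refl → not-¬ Sa Sy₁ }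

  ZIr-card≤r+m : ∀ S → IsZIr G S → ∣ S ∣ ≤ r + m
  ZIr-card≤r+m S zirS = subst (_≤ r + m) (sym (trans (∣p∣≡count-χ S) (count-regions σ))) bound
    where
    open ≤-Reasoning
    σ  = χ S
    cW = count σ 1 r
    cP = count σ (suc r) s
    bound : bool→ℕ (σ 0) + (cW + cP) ≤ r + m
    bound with search (not ∘ σ) 1 r
    ... | inj₂ W⊆S = begin
      bool→ℕ (σ 0) + (cW + cP) ≡⟨ x∙yz≈y∙xz (bool→ℕ (σ 0)) cW cP ⟩
      cW + (bool→ℕ (σ 0) + cP) ≤⟨ +-mono-≤ (count≤length σ 1 r)
                                   (u+pathCount≤m-if-W⊆ S zirS λ i 1≤i i≤r → not≡false⇒≡true (W⊆S i (1≤i , s≤s i≤r))) ⟩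
      r + m                    ∎
    ... | inj₁ (i , i∈W , Si) = withMissingW (σ 0) refl
      where
      cW<r : suc cW ≤ r
      cW<r = count<length σ 1 r i i∈W (not≡true⇒≡false Si)
      withMissingW : ∀ b → σ 0 ≡ b → bool→ℕ b + (cW + cP) ≤ r + m
      withMissingW false _ = begin
        cW + cP     ≤⟨ +-monoʳ-≤ cW (pathCount≤m+1 S zirS) ⟩
        cW + suc m  ≡⟨ +-suc cW m ⟩
        suc cW + m  ≤⟨ +-monoˡ-≤ m cW<r ⟩
        r + m       ∎
      withMissingW true Su with search σ 1 r
      ... | inj₁ (j , (1≤j , j<) , Sj) = +-mono-≤ cW<r (pathCount≤m-if-u-w S zirS Su j 1≤j (≤-pred j<) Sj)
      ... | inj₂ W∩S≡∅ = begin
        1 + (cW + cP) ≡⟨ cong (λ c → 1 + (c + cP)) (count-none σ 1 r W∩S≡∅) ⟩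
        1 + cP        ≤⟨ s≤s (pathCount≤m+1 S zirS) ⟩
        2 + m         ≤⟨ +-monoˡ-≤ m r≥2 ⟩
        r + m         ∎

  evenPath : ℕ → Bool
  evenPath z = even (z ∸ r)

  evenPath-suc : ∀ a → r ≤ a → evenPath (suc a) ≡ not (evenPath a)
  evenPath-suc a r≤a = cong even (+-∸-assoc 1 r≤a)

  evenPath-y₁ : evenPath (suc r) ≡ false
  evenPath-y₁ = trans (evenPath-suc r ≤-refl) (cong (not ∘ even) (n∸n≡0 r))

  evenPath-y₂ : evenPath (suc (suc r)) ≡ true
  evenPath-y₂ = trans (evenPath-suc (suc r) (n≤1+n r)) (cong not evenPath-y₁)

  evenPath-innerIndependent : InnerIndependent evenPath
  evenPath-innerIndependent = evenPath-y₁ , evenPath-yₛ , λ a r<a _ e → trans (evenPath-suc a (<⇒≤ r<a)) (cong not e)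
    where
    evenPath-yₛ : evenPath (r + s) ≡ false
    evenPath-yₛ = trans (cong even (trans (m+n∸m≡n r s) s≡2m+1)) (cong not (even-double m))

  W∪evenPath : ℕ → Bool
  W∪evenPath = byRegion false (λ _ → true) evenPath

  W∪evenPath-card : ∣ ⟦_⟧ {n} W∪evenPath ∣ ≡ r + m
  W∪evenPath-card = trans (∣⟦byRegion⟧∣ false (λ _ → true) evenPath)
    (cong₂ _+_ (count-all (λ _ → true) 1 r λ _ _ → refl) (begin
      count evenPath (suc r) s                       ≡⟨ cong (λ a → count evenPath a s) (+-comm 1 r) ⟩
      count evenPath (r + 1) s                       ≡⟨ count-shift evenPath r 1 s ⟩
      count (λ z → evenPath (r + z)) 1 s             ≡⟨ count-cong _ even 1 s (λ z _ → cong even (m+n∸m≡n r z)) ⟩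
      count even 1 s                                 ≡⟨ cong (count even 1) s≡2m+1 ⟩
      count even 2 (m + m)                           ≡⟨ count-even m 2 refl ⟩
      m                                              ∎))
    where open ≡-Reasoning

  W∪evenPath-isZIr : IsZIr G ⟦ W∪evenPath ⟧
  W∪evenPath-isZIr = isZIr-intro ⟦ W∪evenPath ⟧ λ x x<n Sx → case region x x<n of λ where
      (atU refl)     → ⊥-elim (not-¬ (trans (sym (χ-⟦⟧ W∪evenPath 0 x<n)) Sx) refl)
      (inW 1≤x x≤r)  → privateOfW x 1≤x x≤r
      (onP r<x _)    → privateOfP x r<x (trans (sym (byRegion-P false _ evenPath x r<x)) (trans (sym (χ-⟦⟧ W∪evenPath x x<n)) Sx))
    where
    S = ⟦_⟧ {n} W∪evenPath
    inS : ∀ k → k < n → χ S k ≡ true → W∪evenPath k ≡ true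
    inS k k<n Sk = trans (sym (χ-⟦⟧ W∪evenPath k k<n)) Sk
    privateOfW : ∀ x → 1 ≤ x → x ≤ r → ∃ λ φ → IsFort G ⟦ φ ⟧ × Private S x φ
    privateOfW x 1≤x x≤r = φ , fort-uPath (_≡ᵇ x) evenPath evenPath-innerIndependent ,
                           trans (byRegion-W true (_≡ᵇ x) (not ∘ evenPath) x 1≤x x≤r) (≡ᵇ-refl x) , avoids
      where
      φ = byRegion true (_≡ᵇ x) (not ∘ evenPath)
      avoids : ∀ k → k < n → k ≢ x → χ S k ≡ true → φ k ≡ false
      avoids k k<n k≢x Sk with region k k<n
      ... | atU refl      = ⊥-elim (not-¬ (inS 0 k<n Sk) refl)
      ... | inW 1≤k k≤r   = trans (byRegion-W true (_≡ᵇ x) (not ∘ evenPath) k 1≤k k≤r) (≢⇒≡ᵇ≡false k x k≢x)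
      ... | onP r<k _     = trans (byRegion-P true (_≡ᵇ x) (not ∘ evenPath) k r<k)
                                  (cong not (trans (sym (byRegion-P false _ evenPath k r<k)) (inS k k<n Sk)))
    privateOfP : ∀ x → suc r ≤ x → evenPath x ≡ true → ∃ λ φ → IsFort G ⟦ φ ⟧ × Private S x φ
    privateOfP x r<x evenx = φ , fort-uPath (λ _ → false) X X-innerIndependent , φx , avoids
      where
      X : ℕ → Bool
      X z = evenPath z ∧ not (z ≡ᵇ x)
      φ = byRegion true (λ _ → false) (not ∘ X)
      X-innerIndependent : InnerIndependent X
      X-innerIndependent = let (y₁∉ , yₛ∉ , independent) = evenPath-innerIndependent in
        cong (_∧ not (suc r ≡ᵇ x)) y₁∉ , cong (_∧ not (r + s ≡ᵇ x)) yₛ∉ ,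
        λ a r<a a<yₛ Xa → cong (_∧ not (suc a ≡ᵇ x)) (independent a r<a a<yₛ (proj₁ (∧-true⁻ (evenPath a) Xa)))
      φx : φ x ≡ true
      φx = trans (byRegion-P true (λ _ → false) (not ∘ X) x r<x)
                 (cong not (trans (cong (λ b → evenPath x ∧ not b) (≡ᵇ-refl x)) (∧-zeroʳ (evenPath x))))
      avoids : ∀ k → k < n → k ≢ x → χ S k ≡ true → φ k ≡ false
      avoids k k<n k≢x Sk with region k k<n
      ... | atU refl      = ⊥-elim (not-¬ (inS 0 k<n Sk) refl)
      ... | inW 1≤k k≤r   = byRegion-W true (λ _ → false) (not ∘ X) k 1≤k k≤r
      ... | onP r<k _     = trans (byRegion-P true (λ _ → false) (not ∘ X) k r<k)
                                  (cong not (∧-true⁺ (trans (sym (byRegion-P false _ evenPath k r<k)) (inS k k<n Sk))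
                                                     (cong not (≢⇒≡ᵇ≡false k x k≢x))))

  -- Any extra vertex z of T kills the private fort of y₂: that fort contains u, y₁ and yₛ,
  -- and would otherwise leave the gap z, z + 1.
  W∪evenPath-maximal : ∀ T → ⟦ W∪evenPath ⟧ ⊂ T → ¬ IsZIr G T
  W∪evenPath-maximal T S⊂T zirT = outsider (⊂⇒χ-witness S⊂T)
    where
    open SpanningPrivateFort
    S⊆T : ∀ k → k < n → W∪evenPath k ≡ true → χ T k ≡ true
    S⊆T k k<n e = ⊆⇒χ (proj₁ S⊂T) k k<n (trans (χ-⟦⟧ W∪evenPath k k<n) e)
    inW∪evenPath-P : ∀ k → suc r ≤ k → evenPath k ≡ true → W∪evenPath k ≡ true
    inW∪evenPath-P k r<k e = trans (byRegion-P false (λ _ → true) evenPath k r<k) e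
    y₂ = suc (suc r)
    Ty₂ : χ T y₂ ≡ true
    Ty₂ = S⊆T y₂ (<n y₂≤yₛ) (inW∪evenPath-P y₂ (n≤1+n _) evenPath-y₂)
    Q : SpanningPrivateFort T y₂
    Q = spanningPrivateFort T zirT (λ i 1≤i i≤r → S⊆T i (w<n i≤r) (byRegion-W false (λ _ → true) evenPath i 1≤i i≤r))
                            y₂ Ty₂ (inj₂ (n≤1+n _ , y₂≤yₛ))
    avoids : ∀ k → k < n → k ≢ y₂ → χ T k ≡ true → χ (fort Q) k ≡ false
    avoids = proj₂ (isPrivate Q)
    outsider : (∃ λ z → z < n × χ T z ≡ true × χ (⟦_⟧ {n} W∪evenPath) z ≡ false) → Empty
    outsider (z , z<n , Tz , Sz) with region z z<n
    ... | atU refl    = not-¬ (∋u Q) (avoids 0 z<n (λ ()) Tz)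
    ... | inW 1≤z z≤r = not-¬ (trans (χ-⟦⟧ W∪evenPath z z<n) (byRegion-W false (λ _ → true) evenPath z 1≤z z≤r)) Sz
    ... | onP r<z z≤yₛ with z ≟ suc r | z ≟ r + s
    ...   | yes refl | _        = not-¬ (∋y₁ Q) (avoids (suc r) z<n (1+n≢n ∘ sym) Tz)
    ...   | no _     | yes refl = not-¬ (∋yₛ Q) (avoids (r + s) z<n (λ yₛ≡y₂ → <⇒≢ y₂<yₛ (sym yₛ≡y₂)) Tz)
    ...   | no z≢y₁  | no z≢yₛ  = FortStructure.y₁∈⇒noGap (isFort Q) (∋y₁ Q) z r<z z<yₛ
                                    (avoids z z<n z≢y₂ Tz) (avoids (suc z) (<n z<yₛ) (z≢y₁ ∘ suc-injective) Tz+1)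
      where
      z<yₛ : suc z ≤ r + s
      z<yₛ = ≤∧≢⇒< z≤yₛ z≢yₛ
      oddz : evenPath z ≡ false
      oddz = trans (sym (byRegion-P false (λ _ → true) evenPath z r<z)) (trans (sym (χ-⟦⟧ W∪evenPath z z<n)) Sz)
      z≢y₂ : z ≢ y₂
      z≢y₂ refl = not-¬ evenPath-y₂ oddz
      Tz+1 : χ T (suc z) ≡ true
      Tz+1 = S⊆T (suc z) (<n z<yₛ) (inW∪evenPath-P (suc z) (m<n⇒m<1+n r<z) (trans (evenPath-suc z (<⇒≤ r<z)) (cong not oddz)))

  ZIR≡r+m : ZIRNumber G (r + m)
  ZIR≡r+m = (⟦ W∪evenPath ⟧ , (W∪evenPath-isZIr , W∪evenPath-maximal) , W∪evenPath-card) ,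
            λ S maxS → ZIr-card≤r+m S (proj₁ maxS)

module MinimalZeroForcing (r s : ℕ) (r≥2 : 2 ≤ r) (s≥3 : 3 ≤ s) where
  open Structure r s r≥2 s≥3
  open ZeroForcing r s r≥2 s≥3 using (W∖; W∖-≢; count-W∖; W∖w∪y₁; W∖w∪y₁-reaches; W∖w∪y₁-card; zfs-W-but-one)

  module AllButOneW {i : ℕ} (1≤i : 1 ≤ i) (i≤r : i ≤ r) where

    W∖w∪ : Bool → (ℕ → Bool) → ℕ → Bool
    W∖w∪ bu X = byRegion bu (W∖ i) X

    W∖w⊆ : ∀ bu X j → 1 ≤ j → j ≤ r → j ≢ i → W∖w∪ bu X j ≡ true
    W∖w⊆ bu X j 1≤j j≤r j≢i = trans (byRegion-W bu (W∖ i) X j 1≤j j≤r) (W∖-≢ j≢i)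

    reaches-W∪u∪yₛ : ∀ β → (∀ k → 1 ≤ k → k ≤ r → β k ≡ true) → β 0 ≡ true → β (r + s) ≡ true → Reaches β
    reaches-W∪u∪yₛ β W⊆β βu βyₛ = forceBackward β (r + s) y₁≤yₛ ≤-refl (inj₂ W⊆β)
      (λ c yₛ≤c c≤yₛ → subst (λ a → β a ≡ true) (≤-antisym yₛ≤c c≤yₛ) βyₛ)
      (reaches-done _ λ v v<n → case region v v<n of λ where
        (atU refl)     → ∨-trueˡ _ βu
        (inW 1≤v v≤r)  → ∨-trueˡ _ (W⊆β v 1≤v v≤r)
        (onP r<v v≤yₛ) → ∨-trueʳ (β v) (between⁺ r<v v≤yₛ))

    -- wⱼ forces yₛ, then u forces wᵢ.
    W∖w∪u-reaches : Reaches (W∖w∪ true (λ _ → false))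
    W∖w∪u-reaches with anotherW i
    ... | j , 1≤j , j≤r , j≢i =
      reaches-force β j (r + s) (w<n j≤r) (<n ≤-refl) (W∖w⊆ true _ j 1≤j j≤r j≢i) (Edge⇒adj (wyₛ 1≤j j≤r refl))
      (λ v _ jv v≢yₛ → case w-neighbour j v 1≤j j≤r jv of λ where
        (inj₁ refl) → refl
        (inj₂ v≡yₛ) → ⊥-elim (v≢yₛ v≡yₛ))
      (reaches-force β₁ 0 i (<n z≤n) (w<n i≤r) refl (Edge⇒adj (uw refl 1≤i i≤r))
        (λ v _ uv v≢i → let (1≤v , v≤r) = u-neighbour v uv in ∨-trueˡ _ (W∖w⊆ true _ v 1≤v v≤r v≢i))
        (reaches-W∪u∪yₛ (λ z → β₁ z ∨ (z ≡ᵇ i)) (λ k 1≤k k≤r → case k ≟ i of λ where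
            (yes refl) → ∨-trueʳ (β₁ k) (≡ᵇ-refl k)
            (no k≢i)   → ∨-trueˡ _ (∨-trueˡ _ (W∖w⊆ true _ k 1≤k k≤r k≢i)))
          refl (∨-trueˡ _ (∨-trueʳ (β (r + s)) (≡ᵇ-refl (r + s))))))
      where
      β  = W∖w∪ true (λ _ → false)
      β₁ = λ z → β z ∨ (z ≡ᵇ r + s)

    -- wⱼ forces u, then u forces wᵢ.
    W∖w∪yₛ-reaches : Reaches (W∖w∪ false (_≡ᵇ r + s))
    W∖w∪yₛ-reaches with anotherW i
    ... | j , 1≤j , j≤r , j≢i =
      reaches-force β j 0 (w<n j≤r) (<n z≤n) (W∖w⊆ false _ j 1≤j j≤r j≢i) (Edge⇒adjᵒ (uw refl 1≤j j≤r))
      (λ v _ jv v≢0 → case w-neighbour j v 1≤j j≤r jv of λ where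
        (inj₁ v≡0)  → ⊥-elim (v≢0 v≡0)
        (inj₂ refl) → βyₛ)
      (reaches-force β₁ 0 i (<n z≤n) (w<n i≤r) refl (Edge⇒adj (uw refl 1≤i i≤r))
        (λ v _ uv v≢i → let (1≤v , v≤r) = u-neighbour v uv in ∨-trueˡ _ (W∖w⊆ false _ v 1≤v v≤r v≢i))
        (reaches-W∪u∪yₛ (λ z → β₁ z ∨ (z ≡ᵇ i)) (λ k 1≤k k≤r → case k ≟ i of λ where
            (yes refl) → ∨-trueʳ (β₁ k) (≡ᵇ-refl k)
            (no k≢i)   → ∨-trueˡ _ (∨-trueˡ _ (W∖w⊆ false _ k 1≤k k≤r k≢i)))
          refl (∨-trueˡ _ (∨-trueˡ _ βyₛ))))
      where
      β  = W∖w∪ false (_≡ᵇ r + s)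
      β₁ = λ z → β z ∨ (z ≡ᵇ 0)
      βyₛ : β (r + s) ≡ true
      βyₛ = trans (byRegion-P false (W∖ i) (_≡ᵇ r + s) (r + s) y₁≤yₛ) (≡ᵇ-refl (r + s))

    -- Two consecutive blue path vertices force the path in both directions.
    W∖w∪pair-reaches : ∀ a → suc r ≤ a → suc a ≤ r + s → Reaches (W∖w∪ false (pair a (suc a)))
    W∖w∪pair-reaches a r<a a<yₛ = forceForward β a (suc a) a<yₛ r<a (n≤1+n a) (inj₁ ≤-refl) segment
      (forceBackward γ a r<a (<⇒≤ a<yₛ) (inj₁ a<yₛ) (λ c a≤c c≤yₛ → ∨-trueʳ (β c) (between⁺ a≤c c≤yₛ))
        (reaches-W∖w∪P _ i 1≤i i≤r
          (λ k 1≤k k≤r k≢i → ∨-trueˡ _ (∨-trueˡ _ (W∖w⊆ false _ k 1≤k k≤r k≢i)))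
          (λ c r<c c≤yₛ → ∨-trueʳ (γ c) (between⁺ r<c c≤yₛ))))
      where
      β = W∖w∪ false (pair a (suc a))
      γ = λ z → β z ∨ between a (r + s) z
      segment : ∀ c → a ≤ c → c ≤ suc a → β c ≡ true
      segment c a≤c c≤a+1 = trans (byRegion-P false (W∖ i) (pair a (suc a)) c (≤-trans r<a a≤c)) (case m≤n⇒m<n∨m≡n c≤a+1 of λ where
        (inj₁ c≤a)  → subst (λ b → pair a (suc a) b ≡ true) (≤-antisym a≤c (≤-pred c≤a)) (pairˡ a (suc a))
        (inj₂ refl) → pairʳ a (suc a))

    W∖w∪-count : ∀ bu X → count (W∖w∪ bu X) 0 n + 1 ≡ r + (bool→ℕ bu + count X (suc r) s)
    W∖w∪-count bu X = begin
      count (W∖w∪ bu X) 0 n + 1 ≡⟨ cong (_+ 1) (count-byRegion bu (W∖ i) X) ⟩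
      (b + (cW + cX)) + 1       ≡⟨ solve 3 (λ b c x → (b :+ (c :+ x)) :+ con 1 := (c :+ con 1) :+ (b :+ x)) refl b cW cX ⟩
      (cW + 1) + (b + cX)       ≡⟨ cong (_+ (b + cX)) (count-W∖ 1≤i i≤r) ⟩
      r + (b + cX)              ∎
      where
      open ≡-Reasoning
      open +-*-Solver using (solve; _:+_; _:=_; con)
      b  = bool→ℕ bu
      cW = count (W∖ i) 1 r
      cX = count X (suc r) s

    W∖w∪-count≤ : ∀ bu X t → bool→ℕ bu + count X (suc r) s ≤ suc t → count (W∖w∪ bu X) 0 n ≤ t + r
    W∖w∪-count≤ bu X t bound = ≤-pred (begin
      suc (count (W∖w∪ bu X) 0 n)          ≡⟨ +-comm 1 _ ⟩
      count (W∖w∪ bu X) 0 n + 1            ≡⟨ W∖w∪-count bu X ⟩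
      r + (bool→ℕ bu + count X (suc r) s)  ≤⟨ +-monoʳ-≤ r bound ⟩
      r + suc t                            ≡⟨ +-comm r (suc t) ⟩
      suc t + r                            ∎)
      where open ≤-Reasoning

  -- Otherwise B would miss the fort {u} ∪ (W ∖ B) ∪ (P ∖ B).
  zfs-adjacentPathPair : ∀ B → ZFReaches G B → χ B 0 ≡ false → χ B (suc r) ≡ false → χ B (r + s) ≡ false →
                         ∃ λ a → suc r ≤ a × suc a ≤ r + s × χ B a ≡ true × χ B (suc a) ≡ true
  zfs-adjacentPathPair B R Bu By₁ Byₛ with search (λ k → χ B k ∧ χ B (suc k)) (suc r) s
  ... | inj₁ (a , (r<a , a<) , e) = let Ba , Ba+1 = ∧-true⁻ (χ B a) e in
    a , r<a , ≤∧≢⇒< (≤-pred a<) (λ { refl → not-¬ Ba Byₛ }) , Ba , Ba+1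
  ... | inj₂ noAdjacent = ⊥-elim (¬reaches-outside-fort B (byRegion true (not ∘ χ B) (not ∘ χ B))
    (fort-uPath (not ∘ χ B) (χ B) (By₁ , Byₛ , λ a r<a a<yₛ Ba →
      trans (sym (cong (_∧ χ B (suc a)) Ba)) (noAdjacent a (r<a , s≤s (<⇒≤ a<yₛ)))))
    (λ k k<n Bk → case region k k<n of λ where
      (atU refl)    → ⊥-elim (not-¬ Bk Bu)
      (inW 1≤k k≤r) → trans (byRegion-W true (not ∘ χ B) (not ∘ χ B) k 1≤k k≤r) (cong not Bk)
      (onP r<k _)   → trans (byRegion-P true (not ∘ χ B) (not ∘ χ B) k r<k) (cong not Bk))
    R)

  record SmallZFSWithin (B : Subset n) : Set where
    field
      β       : ℕ → Bool
      reaches : Reaches β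
      β⊆B     : ∀ k → k < n → β k ≡ true → χ B k ≡ true
      small   : count β 0 n ≤ r ⊎ (4 ≤ s × count β 0 n ≤ suc r)

  -- Besides all of W but some wᵢ, B contains u, y₁, yₛ or two adjacent path vertices.
  smallZFSWithin : ∀ B → ZFReaches G B → SmallZFSWithin B
  smallZFSWithin B R with zfs-W-but-one B R
  ... | i , 1≤i , i≤r , W∖i⊆B = byCases (σ 0) refl
    where
    open AllButOneW 1≤i i≤r
    σ = χ B
    within : ∀ bu X → (bu ≡ true → σ 0 ≡ true) → (∀ k → suc r ≤ k → X k ≡ true → σ k ≡ true) →
             ∀ k → k < n → W∖w∪ bu X k ≡ true → σ k ≡ true
    within bu X u⇒ X⇒ k k<n e with region k k<n
    ... | atU refl      = u⇒ e
    ... | inW 1≤k k≤r   = W∖i⊆B k 1≤k k≤r λ { refl → not-¬ (trans (sym (byRegion-W bu (W∖ i) X k 1≤k k≤r)) e) (cong not (≡ᵇ-refl k)) }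
    ... | onP r<k _     = X⇒ k r<k (trans (sym (byRegion-P bu (W∖ i) X k r<k)) e)
    single : ∀ v → σ v ≡ true → ∀ k → suc r ≤ k → (k ≡ᵇ v) ≡ true → σ k ≡ true
    single v σv k _ e = subst (λ a → σ a ≡ true) (sym (≡ᵇ≡true⇒≡ k v e)) σv
    byCases : ∀ b → σ 0 ≡ b → SmallZFSWithin B
    byCases true  Bu = record
      { β = W∖w∪ true (λ _ → false) ; reaches = W∖w∪u-reaches
      ; β⊆B = within true (λ _ → false) (λ _ → Bu) (λ _ _ ())
      ; small = inj₁ (W∖w∪-count≤ true (λ _ → false) 0 (≤-reflexive (cong suc (count-none _ (suc r) s λ _ _ → refl)))) }
    byCases false Bu with σ (suc r) in By₁ | σ (r + s) in Byₛ
    ... | true  | _    = record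
      { β = W∖w∪ false (_≡ᵇ suc r) ; reaches = W∖w∪y₁-reaches 1≤i i≤r
      ; β⊆B = within false (_≡ᵇ suc r) (λ ()) (single (suc r) By₁)
      ; small = inj₁ (W∖w∪-count≤ false (_≡ᵇ suc r) 0 (count-≡ᵇ≤1 (suc r) (suc r) s)) }
    ... | false | true = record
      { β = W∖w∪ false (_≡ᵇ r + s) ; reaches = W∖w∪yₛ-reaches
      ; β⊆B = within false (_≡ᵇ r + s) (λ ()) (single (r + s) Byₛ)
      ; small = inj₁ (W∖w∪-count≤ false (_≡ᵇ r + s) 0 (count-≡ᵇ≤1 (r + s) (suc r) s)) }
    ... | false | false with zfs-adjacentPathPair B R Bu By₁ Byₛ
    ...   | a , r<a , a<yₛ , Ba , Ba+1 = record
      { β = W∖w∪ false (pair a (suc a)) ; reaches = W∖w∪pair-reaches a r<a a<yₛ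
      ; β⊆B = within false (pair a (suc a)) (λ ()) λ k _ e → case pair⁻ a (suc a) k e of λ where
          (inj₁ refl) → Ba
          (inj₂ refl) → Ba+1
      ; small = inj₂ (adjacentInner⇒s≥4 a (≤∧≢⇒< r<a λ { refl → not-¬ Ba By₁ })
                        (≤∧≢⇒< a<yₛ λ a+1≡yₛ → not-¬ Ba+1 (subst (λ b → σ b ≡ false) (sym a+1≡yₛ) Byₛ)) ,
                      W∖w∪-count≤ false (pair a (suc a)) 1 (count-pair≤2 a (suc a) (suc r) s)) }

  minimalZFS-card : ∀ B → IsMinimalZFS G B → ∣ B ∣ ≤ r ⊎ (4 ≤ s × ∣ B ∣ ≤ suc r)
  minimalZFS-card B (R , minimal) = map-⊎ (≤-trans B≤β) (map₂ (≤-trans B≤β)) small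
    where
    open SmallZFSWithin (smallZFSWithin B R)
    B⊆β : B ⊆ ⟦ β ⟧
    B⊆β {x} x∈B with x ∈? ⟦ β ⟧
    ... | yes x∈β = x∈β
    ... | no  x∉β = ⊥-elim (minimal ⟦ β ⟧
      (χ⇒⊂ ⟦ β ⟧ B (λ k k<n e → β⊆B k k<n (trans (sym (χ-⟦⟧ β k k<n)) e)) (toℕ x) (toℕ<n x) (∈⇒χ x∈B) (∉⇒χ x _ x∉β))
      reaches)
    B≤β : ∣ B ∣ ≤ count β 0 n
    B≤β = subst (∣ B ∣ ≤_) (∣⟦⟧∣ {n} β) (p⊆q⇒∣p∣≤∣q∣ B⊆β)

  -- A proper subset misses wⱼ (j ≠ 1), and then the fort {w₁, wⱼ}; or it misses z ∈ X, and then the fort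
  -- {u, w₁} ∪ P ∖ (X ∖ {z}).
  W∖w₁∪-noProperZFS : ∀ X → (∀ z → suc r ≤ z → X z ≡ true → InnerIndependent (λ k → X k ∧ not (k ≡ᵇ z))) →
                      ∀ S → S ⊂ ⟦ byRegion false (W∖ 1) X ⟧ → ¬ ZFReaches G S
  W∖w₁∪-noProperZFS X X∖z-independent S S⊂B with ⊂⇒χ-witness S⊂B
  ... | z , z<n , Bz , Sz = let φ , isFort , disjoint = fortFor (region z z<n) in ¬reaches-outside-fort S φ isFort disjoint
    where
    B = byRegion false (W∖ 1) X
    S⊆B : ∀ k → k < n → χ S k ≡ true → B k ≡ true
    S⊆B k k<n Sk = trans (sym (χ-⟦⟧ B k k<n)) (⊆⇒χ (proj₁ S⊂B) k k<n Sk)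
    Bz′ : B z ≡ true
    Bz′ = trans (sym (χ-⟦⟧ B z z<n)) Bz
    S∌w₁ : χ S 1 ≡ false
    S∌w₁ = ¬-not λ Sw₁ → not-¬ (trans (sym (byRegion-W false (W∖ 1) X 1 ≤-refl r≥1)) (S⊆B 1 (w<n r≥1) Sw₁)) refl
    fortFor : Region z → ∃ λ φ → IsFort G ⟦ φ ⟧ × (∀ k → k < n → χ S k ≡ true → φ k ≡ false)
    fortFor (atU refl)     = ⊥-elim (not-¬ Bz′ refl)
    fortFor (inW 1≤z z≤r)  = pair 1 z , fort-pair ≤-refl r≥1 1≤z z≤r 1≢z , λ k k<n Sk → ¬-not λ e → case pair⁻ 1 z k e of λ where
        (inj₁ refl) → not-¬ Sk S∌w₁
        (inj₂ refl) → not-¬ Sk Sz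
      where
      1≢z : 1 ≢ z
      1≢z refl = not-¬ (trans (sym (byRegion-W false (W∖ 1) X 1 ≤-refl r≥1)) Bz′) refl
    fortFor (onP r<z z≤yₛ) = byRegion true (_≡ᵇ 1) (not ∘ Y) , fort-uPath (_≡ᵇ 1) Y (X∖z-independent z r<z Xz) , avoids
      where
      Y : ℕ → Bool
      Y k = X k ∧ not (k ≡ᵇ z)
      Xz : X z ≡ true
      Xz = trans (sym (byRegion-P false (W∖ 1) X z r<z)) Bz′
      avoids : ∀ k → k < n → χ S k ≡ true → byRegion true (_≡ᵇ 1) (not ∘ Y) k ≡ false
      avoids k k<n Sk with region k k<n
      ... | atU refl      = ⊥-elim (not-¬ (S⊆B 0 k<n Sk) refl)
      ... | inW 1≤k k≤r   = trans (byRegion-W true (_≡ᵇ 1) (not ∘ Y) k 1≤k k≤r)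
                                  (≢⇒≡ᵇ≡false k 1 λ { refl → not-¬ Sk S∌w₁ })
      ... | onP r<k _     = trans (byRegion-P true (_≡ᵇ 1) (not ∘ Y) k r<k) (cong not (∧-true⁺
                                  (trans (sym (byRegion-P false (W∖ 1) X k r<k)) (S⊆B k k<n Sk))
                                  (cong not (≢⇒≡ᵇ≡false k z λ { refl → not-¬ Sk Sz }))))

  innerIndependent-≤1 : ∀ X → X (suc r) ≡ false → X (r + s) ≡ false → (∀ a b → X a ≡ true → X b ≡ true → a ≡ b) →
                        InnerIndependent X
  innerIndependent-≤1 X Xy₁ Xyₛ unique = Xy₁ , Xyₛ , λ a _ _ Xa → ¬-not λ Xa+1 → 1+n≢n (sym (unique a (suc a) Xa Xa+1))

  W∖w₁∪y₁-minimal : IsMinimalZFS G ⟦ W∖w∪y₁ 1 ⟧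
  W∖w₁∪y₁-minimal = W∖w∪y₁-reaches ≤-refl r≥1 , W∖w₁∪-noProperZFS (_≡ᵇ suc r) λ z _ z≡y₁ →
    let empty : ∀ k → ((k ≡ᵇ suc r) ∧ not (k ≡ᵇ z)) ≡ false
        empty k = ¬-not λ e → let k≡y₁ , k≢z = ∧-true⁻ (k ≡ᵇ suc r) e in
          not-¬ (≡⇒≡ᵇ≡true k z (trans (≡ᵇ≡true⇒≡ k (suc r) k≡y₁) (sym (≡ᵇ≡true⇒≡ z (suc r) z≡y₁)))) (not≡true⇒≡false k≢z)
    in innerIndependent-≤1 _ (empty (suc r)) (empty (r + s)) λ a _ Ya _ → ⊥-elim (not-¬ Ya (empty a))

  module _ (s≥5 : 5 ≤ s) where

    y₂ y₃ : ℕ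
    y₂ = suc (suc r)
    y₃ = suc y₂

    y₃<yₛ : suc y₃ ≤ r + s
    y₃<yₛ = subst (_≤ r + s) (+-comm r 4) (+-monoʳ-≤ r (≤-trans (n≤1+n 4) s≥5))

    W∖w₁∪y₂y₃ : ℕ → Bool
    W∖w₁∪y₂y₃ = byRegion false (W∖ 1) (pair y₂ y₃)

    y₁<y₂ : suc r < y₂
    y₁<y₂ = n<1+n (suc r)

    y₁<y₃ : suc r < y₃
    y₁<y₃ = m<n⇒m<1+n y₁<y₂

    W∖w₁∪y₂y₃-minimal : IsMinimalZFS G ⟦ W∖w₁∪y₂y₃ ⟧
    W∖w₁∪y₂y₃-minimal = AllButOneW.W∖w∪pair-reaches ≤-refl r≥1 y₂ (n≤1+n _) (<⇒≤ y₃<yₛ) ,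
      W∖w₁∪-noProperZFS (pair y₂ y₃) λ z _ Xz → innerIndependent-≤1 _
        (cong (_∧ not (suc r ≡ᵇ z)) (pair-≢ y₂ y₃ (suc r) (<⇒≢ y₁<y₂) (<⇒≢ y₁<y₃)))
        (cong (_∧ not (r + s ≡ᵇ z)) (pair-≢ y₂ y₃ (r + s) (<⇒≢ y₂<yₛ ∘ sym) (<⇒≢ y₃<yₛ ∘ sym)))
        (unique z (pair⁻ y₂ y₃ z Xz))
      where
      unique : ∀ z → z ≡ y₂ ⊎ z ≡ y₃ → ∀ a b →
               (pair y₂ y₃ a ∧ not (a ≡ᵇ z)) ≡ true → (pair y₂ y₃ b ∧ not (b ≡ᵇ z)) ≡ true → a ≡ b
      unique z z∈ a b Ya Yb with ∧-true⁻ (pair y₂ y₃ a) Ya | ∧-true⁻ (pair y₂ y₃ b) Yb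
      ... | Xa , a≢z | Xb , b≢z with pair⁻ y₂ y₃ a Xa | pair⁻ y₂ y₃ b Xb
      ...   | inj₁ a≡ | inj₁ b≡ = trans a≡ (sym b≡)
      ...   | inj₂ a≡ | inj₂ b≡ = trans a≡ (sym b≡)
      ...   | inj₁ refl | inj₂ refl = ⊥-elim (case z∈ of λ where
                (inj₁ refl) → not-¬ (≡ᵇ-refl a) (not≡true⇒≡false a≢z)
                (inj₂ refl) → not-¬ (≡ᵇ-refl b) (not≡true⇒≡false b≢z))
      ...   | inj₂ refl | inj₁ refl = ⊥-elim (case z∈ of λ where
                (inj₁ refl) → not-¬ (≡ᵇ-refl b) (not≡true⇒≡false b≢z)
                (inj₂ refl) → not-¬ (≡ᵇ-refl a) (not≡true⇒≡false a≢z))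

    W∖w₁∪y₂y₃-card : ∣ ⟦_⟧ {n} W∖w₁∪y₂y₃ ∣ ≡ suc r
    W∖w₁∪y₂y₃-card = trans (∣⟦⟧∣ {n} W∖w₁∪y₂y₃) (+-cancelʳ-≡ 1 _ (suc r) (begin
      count W∖w₁∪y₂y₃ 0 n + 1                   ≡⟨ AllButOneW.W∖w∪-count ≤-refl r≥1 false (pair y₂ y₃) ⟩
      r + count (pair y₂ y₃) (suc r) s          ≡⟨ cong (r +_) (count-pair y₂ y₃ (suc r) s (<⇒≤ y₁<y₂ , y₂∈) (<⇒≤ y₁<y₃ , y₃∈)
                                                                         (<⇒≢ (n<1+n y₂))) ⟩
      r + 2                                     ≡⟨ +-suc r 1 ⟩
      suc r + 1                                 ∎))
      where
      open ≡-Reasoning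
      y₃∈ : y₃ < suc r + s
      y₃∈ = s≤s (<⇒≤ y₃<yₛ)
      y₂∈ : y₂ < suc r + s
      y₂∈ = <-trans (n<1+n y₂) y₃∈

    Zbar≡r+1 : UpperZeroForcingNumber G (suc r)
    Zbar≡r+1 = (⟦ W∖w₁∪y₂y₃ ⟧ , W∖w₁∪y₂y₃-minimal , W∖w₁∪y₂y₃-card) ,
               λ B minB → [ m≤n⇒m≤1+n , proj₂ ]′ (minimalZFS-card B minB)

  Zbar≡r-if-s≡3 : s ≡ 3 → UpperZeroForcingNumber G r
  Zbar≡r-if-s≡3 s≡3 = (⟦ W∖w∪y₁ 1 ⟧ , W∖w₁∪y₁-minimal , W∖w∪y₁-card ≤-refl r≥1) ,
                      λ B minB → [ id , (λ (s≥4 , _) → ⊥-elim (<⇒≱ (s≤s (≤-reflexive s≡3)) s≥4)) ]′ (minimalZFS-card B minB)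

odd≡1+half*2 : ∀ s → s % 2 ≡ 1 → s ≡ suc (s / 2 * 2)
odd≡1+half*2 s odd = trans (m≡m%n+[m/n]*n s 2) (cong (_+ s / 2 * 2) odd)

odd≡1+half+half : ∀ s → s % 2 ≡ 1 → s ≡ suc (s / 2 + s / 2)
odd≡1+half+half s odd = trans (odd≡1+half*2 s odd) (cong suc (trans (*-comm (s / 2) 2) (cong (s / 2 +_) (+-identityʳ (s / 2)))))

odd⇒[s∸1]/2≡s/2 : ∀ s → s % 2 ≡ 1 → (s ∸ 1) / 2 ≡ s / 2
odd⇒[s∸1]/2≡s/2 s odd = trans (cong (λ x → (x ∸ 1) / 2) (odd≡1+half*2 s odd)) (m*n/n≡m (s / 2) 2)

proposition3p6 :
    ((r s : ℕ) → 2 ≤ r → 3 ≤ s → s % 2 ≡ 1 →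
       zirNumber (H r s) 2
       × ZeroForcingNumber (H r s) r
       × ZIRNumber (H r s) (r + (s ∸ 1) / 2))
    × ((r s : ℕ) → 2 ≤ r → 5 ≤ s → s % 2 ≡ 1 →
       UpperZeroForcingNumber (H r s) (r + 1))
    × ((r : ℕ) → 2 ≤ r → UpperZeroForcingNumber (H r 3) r)
proposition3p6 =
  (λ r s r≥2 s≥3 odd →
    SmallestMaximalZIr.zir≡2 r s r≥2 s≥3 ,
    ZeroForcing.Z≡r r s r≥2 s≥3 ,
    subst (λ k → ZIRNumber (H r s) (r + k)) (sym (odd⇒[s∸1]/2≡s/2 s odd))
          (LargestZIr.ZIR≡r+m r s r≥2 s≥3 (s / 2) (odd≡1+half+half s odd))) ,
  (λ r s r≥2 s≥5 _ → subst (UpperZeroForcingNumber (H r s)) (+-comm 1 r)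
    (MinimalZeroForcing.Zbar≡r+1 r s r≥2 (≤-trans (m≤m+n 3 2) s≥5) s≥5)) ,
  (λ r r≥2 → MinimalZeroForcing.Zbar≡r-if-s≡3 r 3 r≥2 ≤-refl refl)
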